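{- Let $G$ be a generalized quadratic form in $n$ variables over $K=\mathbb{Q}(\sqrt{D})$ as described in the context, with matrix $M_G$, and let $Q$ be the quadratic form in $2n$ variables associated to $G$, with matrix $M_Q$. Then \[ \det(M_Q) = D^n\cdot\begin{cases}\det(2M_G), & \text{if } D\equiv 2,3 \pmod 4,\\ \det(M_G), & \text{if } D\equiv 1\pmod 4.\end{cases} \]
   Context: Let $K=\mathbb{Q}(\sqrt{D})$ where $D\in\mathbb{Z}\setminus\{0,1\}$ is squarefree, and let $\tau$ denote the nontrivial automorphism $a+b\sqrt{D}\mapsto a-b\sqrt{D}$. Let $\omega_D=\sqrt{D}$ if $D\equiv 2,3\pmod 4$ and $\omega_D=\frac{1+\sqrt{D}}{2}$ if $D\equiv 1\pmod 4$, so $(1,\omega_D)$ is a basis of the ring of integers of $K$. A generalized quadratic form in $n$ variables over $K$ is \[ G(z_1,\dots,z_n)=\sum_{1\le i\le j\le n}\alpha_{ij}z_iz_j+\sum_{1\le i,j\le n}\beta_{ij}z_i\tau(z_j)+\sum_{1\le i\le j\le n}\gamma_{ij}\tau(z_i)\tau(z_j) \] with $\alpha_{ij},\beta_{ij},\gamma_{ij}\in K$. Its matrix is the $2n\times 2n$ matrix $M_G=\begin{pmatrix}A & P\\ P^\top & C\end{pmatrix}$, where $A$ is the symmetric $n\times n$ matrix with diagonal entries $\alpha_{ii}$ and off-diagonal entries $\alpha_{ij}/2$, $C$ is the symmetric $n\times n$ matrix with diagonal entries $\gamma_{ii}$ and off-diagonal entries $\gamma_{ij}/2$, and $P$ is the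 $n\times n$ matrix with $(i,j)$-entry $\beta_{ij}/2$; thus $G(\mathbf z)=(\mathbf z,\tau(\mathbf z))M_G(\mathbf z,\tau(\mathbf z))^\top$. The associated quadratic form is $Q(x_1,y_1,\dots,x_n,y_n)=G(x_1+y_1\omega_D,\dots,x_n+y_n\omega_D)$, and $M_Q$ is its symmetric matrix (diagonal entries the coefficients of squares, off-diagonal entries half the cross-term coefficients). -}

module Defs where

open import Data.Nat as ℕ using (ℕ; zero; suc)
open import Data.Integer as ℤ using (ℤ; ∣_∣)
open import Data.Integer.DivMod using (_%ℕ_)
open import Data.Rational as ℚ using (ℚ; 0ℚ; 1ℚ; ½)
open import Data.Fin as Fin using (Fin; punchIn; splitAt; remQuot)
open import Data.Sum using (inj₁; inj₂)
open import Data.Product using (_×_; _,_; proj₁; proj₂)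
open import Data.Nat.Divisibility using (_∣_)
open import Relation.Nullary using (yes; no; ¬_)
open import Relation.Binary.PropositionalEquality using (_≡_)

SquareFree : ℤ → Set
SquareFree D = (k : ℕ) → (k ℕ.* k) ∣ ∣ D ∣ → k ≡ 1

-- D mod 4, as a natural number in {0,1,2,3} (also for negative D).
Dmod4 : ℤ → ℕ
Dmod4 D = D %ℕ 4

-- The field K = ℚ(√D): an element (a , b) stands for a + b √D.

K : Set
K = ℚ × ℚ

module Field (D : ℤ) where
  Dℚ : ℚ
  Dℚ = D ℚ./ 1

  0K 1K 2K : K
  0K = 0ℚ , 0ℚ
  1K = 1ℚ , 0ℚ
  2K = 1ℚ ℚ.+ 1ℚ , 0ℚ

  DK : K
  DK = Dℚ , 0ℚ

  infixl 6 _+K_ _-K_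
  infixl 7 _*K_

  _+K_ : K → K → K
  (a , b) +K (c , d) = a ℚ.+ c , b ℚ.+ d

  -K_ : K → K
  -K (a , b) = ℚ.- a , ℚ.- b

  _-K_ : K → K → K
  x -K y = x +K (-K y)

  -- (a + b√D)(c + d√D) = (ac + D bd) + (ad + bc)√D
  _*K_ : K → K → K
  (a , b) *K (c , d) = a ℚ.* c ℚ.+ Dℚ ℚ.* (b ℚ.* d) , a ℚ.* d ℚ.+ b ℚ.* c

  halfK : K → K
  halfK (a , b) = ½ ℚ.* a , ½ ℚ.* b

  _^K_ : K → ℕ → K
  x ^K zero  = 1K
  x ^K suc n = x *K (x ^K n)

  τ : K → K
  τ (a , b) = a , ℚ.- b

  -- ω_D = (1 + √D)/2 if D ≡ 1 (mod 4), and ω_D = √D otherwise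
  -- (for squarefree D ≠ 0,1 "otherwise" means D ≡ 2,3 (mod 4)).
  ω : K
  ω with Dmod4 D ℕ.≟ 1
  ... | yes _ = ½ , ½
  ... | no  _ = 0ℚ , 1ℚ

  ΣK : (n : ℕ) → (Fin n → K) → K
  ΣK zero    f = 0K
  ΣK (suc n) f = f Fin.zero +K ΣK n (λ i → f (Fin.suc i))

  Mat : ℕ → Set
  Mat m = Fin m → Fin m → K

  sgn : {m : ℕ} → Fin m → K
  sgn Fin.zero    = 1K
  sgn (Fin.suc j) = -K sgn j

  det : (m : ℕ) → Mat m → K
  det zero    M = 1K
  det (suc m) M =
    ΣK (suc m) (λ j → sgn j *K M Fin.zero j *K det m (λ i k → M (Fin.suc i) (punchIn j k)))

  scale : {m : ℕ} → K → Mat m → Mat m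
  scale c M i j = c *K M i j

  -- The coefficients are
  -- given as functions Fin n → Fin n → K; for α and γ only the entries
  -- α i j, γ i j with i ≤ j are used (as in the paper's sum over i ≤ j).

  record GenQuadForm (n : ℕ) : Set where
    field
      α β γ : Fin n → Fin n → K

  open GenQuadForm public

  ΣΣ≤ : (n : ℕ) → (Fin n → Fin n → K) → K
  ΣΣ≤ n f = ΣK n (λ i → ΣK n (λ j → sel i j))
    where
      sel : Fin n → Fin n → K
      sel i j with i Fin.≤? j
      ... | yes _ = f i j
      ... | no  _ = 0K

  evalG : {n : ℕ} → GenQuadForm n → (Fin n → K) → K
  evalG {n} G z =
        ΣΣ≤ n (λ i j → α G i j *K z i *K z j)
    +K ΣK n (λ i → ΣK n (λ j → β G i j *K z i *K τ (z j)))
    +K ΣΣ≤ n (λ i j → γ G i j *K τ (z i) *K τ (z j))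

  symHalf : {n : ℕ} → (Fin n → Fin n → K) → Mat n
  symHalf c i j with i Fin.≟ j
  ... | yes _ = c i j
  ... | no  _ with i Fin.<? j
  ...   | yes _ = halfK (c i j)
  ...   | no  _ = halfK (c j i)

  MG : {n : ℕ} → GenQuadForm n → Mat (n ℕ.+ n)
  MG {n} G u v with splitAt n u | splitAt n v
  ... | inj₁ i | inj₁ j = symHalf (α G) i j
  ... | inj₁ i | inj₂ j = halfK (β G i j)
  ... | inj₂ i | inj₁ j = halfK (β G j i)
  ... | inj₂ i | inj₂ j = symHalf (γ G) i j

  -- The associated quadratic form Q in the 2n variables
  -- (x₁, y₁, …, xₙ, yₙ); the variable with index combine i 0 is x_i and
  -- the one with index combine i 1 is y_i (interleaved order).
  evalQ : {n : ℕ} → GenQuadForm n → (Fin (n ℕ.* 2) → K) → K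
  evalQ {n} G w = evalG G (λ i → x i +K y i *K ω)
    where
      x y : Fin n → K
      x i = w (Fin.combine i Fin.zero)
      y i = w (Fin.combine i (Fin.suc Fin.zero))

  e : {m : ℕ} → Fin m → Fin m → K
  e u v with u Fin.≟ v
  ... | yes _ = 1K
  ... | no  _ = 0K

  -- The symmetric matrix of a quadratic form q in m variables:
  -- diagonal entry = coefficient of w_u² = q(e_u);
  -- off-diagonal entry = half the coefficient of w_u w_v
  --                    = (q(e_u + e_v) - q(e_u) - q(e_v)) / 2.
  symMatrix : {m : ℕ} → ((Fin m → K) → K) → Mat m
  symMatrix q u v with u Fin.≟ v
  ... | yes _ = q (e u)
  ... | no  _ = halfK (q (λ t → e u t +K e v t) -K q (e u) -K q (e v))

  MQ : {n : ℕ} → GenQuadForm n → Mat (n ℕ.* 2)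
  MQ G = symMatrix (evalQ G)

{-# OPTIONS --safe #-}
module Submission where

-- Write z = x + y ω. Then (z, τ z) = Ω (x, y) with Ω = (1 ω; 1 τω), so once the coordinates of Q and
-- of (z, τ z) are both put in interleaved order, Q(w) = G(z) = (z, τ z) M_G (z, τ z)ᵀ says that
-- M_Q = Tᵀ M_G′ T, where T is block diagonal with n copies of Ω and M_G′ is M_G with rows and columns
-- simultaneously permuted. Hence det M_Q = (det Ω)^(2n) det M_G, and (det Ω)² = (τω - ω)² is D when
-- ω = (1 + √D)/2 and 4D when ω = √D, where 4^n det M_G = det (2 M_G).
--
-- The determinant identities used come from the uniqueness of alternating multilinear functions of
-- the columns, f M = det M · f 1, proved by expanding f along the first column, clearing the rest of
-- the row of each pivot by column operations, and recursing on the remaining minor.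

open import Algebra.Bundles using (CommutativeRing)
open import Algebra.Core using (Op₁; Op₂)
open import Algebra.Structures using (IsCommutativeRing)
open import Data.Empty using (⊥-elim)
open import Data.Fin as Fin using (Fin; zero; suc; punchIn; punchOut; inject₁; _≟_; _↑ˡ_; _↑ʳ_)
open import Data.Fin.Induction using (<-weakInduction)
open import Data.Fin.Permutation as Perm using (Permutation; Permutation′; _⟨$⟩ʳ_; _⟨$⟩ˡ_)
open import Data.Fin.Properties
  using (remQuot-combine; combine-remQuot; splitAt-↑ˡ; splitAt-↑ʳ; splitAt⁻¹-↑ˡ; splitAt⁻¹-↑ʳ;
         punchInᵢ≢i; punchIn-punchOut; punchIn-injective; suc-injective;
         <-cmp; <-irrefl; <-asym; <⇒≢; ≤∧≢⇒<; <⇒≤pred; ≤̄⇒inject₁<; ≤-refl)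
open import Data.Integer using (ℤ)
open import Data.Nat using (ℕ; zero; suc)
import Data.Nat as ℕ
open import Data.Nat.Properties using (<⇒≱; <⇒≤)
open import Data.Product using (_×_; _,_; ∃-syntax; Σ-syntax; proj₁; proj₂; uncurry)
open import Data.Rational as ℚ using (ℚ; 0ℚ; 1ℚ; ½)
import Data.Rational.Properties as ℚ
open import Data.Rational.Solver using (module +-*-Solver)
open import Data.Sum using (_⊎_; inj₁; inj₂; [_,_]′)
open import Data.Vec.Functional using (Vector; updateAt; insertAt; _∷_; tail; _++_)
open import Data.Vec.Functional.Properties
  using (updateAt-updates; updateAt-minimal; insertAt-lookup; insertAt-punchIn; lookup-++ˡ; lookup-++ʳ)
open import Function using (_∘_; const)
open import Relation.Binary.Definitions using (tri<; tri≈; tri>)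
open import Relation.Binary.PropositionalEquality
open import Relation.Nullary using (¬_; yes; no)

open import Defs

punchIn-inject₁-self : ∀ {n} (k : Fin n) → punchIn (inject₁ k) k ≡ suc k
punchIn-inject₁-self zero    = refl
punchIn-inject₁-self (suc k) = cong suc (punchIn-inject₁-self k)

punchIn-suc-self : ∀ {n} (k : Fin n) → punchIn (suc k) k ≡ inject₁ k
punchIn-suc-self zero    = refl
punchIn-suc-self (suc k) = cong suc (punchIn-suc-self k)

punchIn-inject₁≡punchIn-suc : ∀ {n} (k l : Fin n) → l ≢ k → punchIn (inject₁ k) l ≡ punchIn (suc k) l
punchIn-inject₁≡punchIn-suc zero    zero    l≢k = ⊥-elim (l≢k refl)
punchIn-inject₁≡punchIn-suc zero    (suc l) _   = refl
punchIn-inject₁≡punchIn-suc (suc k) zero    _   = refl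
punchIn-inject₁≡punchIn-suc (suc k) (suc l) l≢k =
  cong suc (punchIn-inject₁≡punchIn-suc k l (l≢k ∘ cong suc))

punchIn-adjacent : ∀ {n} (j : Fin (suc (suc n))) (k : Fin (suc n)) → j ≢ inject₁ k → j ≢ suc k →
                   ∃[ k′ ] punchIn j (inject₁ k′) ≡ inject₁ k × punchIn j (suc k′) ≡ suc k
punchIn-adjacent zero    zero    j≢k _    = ⊥-elim (j≢k refl)
punchIn-adjacent zero    (suc k) _   _    = k , refl , refl
punchIn-adjacent (suc zero) zero _   j≢sk = ⊥-elim (j≢sk refl)
punchIn-adjacent {suc n} (suc (suc j)) zero _ _ = zero , refl , refl
punchIn-adjacent {suc n} (suc j) (suc k) j≢k j≢sk
  with punchIn-adjacent j k (j≢k ∘ cong suc) (j≢sk ∘ cong suc)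
... | k′ , p , q = suc k′ , cong suc p , cong suc q

punchIn-ind : ∀ {n ℓ} (i : Fin (suc n)) (P : Fin (suc n) → Set ℓ) →
              P i → (∀ k → P (punchIn i k)) → ∀ r → P r
punchIn-ind i P Pᵢ P-punchIn r with i ≟ r
... | yes refl = Pᵢ
... | no i≢r   = subst P (punchIn-punchOut i≢r) (P-punchIn (punchOut i≢r))

combine-ind : ∀ {n k ℓ} (P : Fin (n ℕ.* k) → Set ℓ) → (∀ i b → P (Fin.combine i b)) → ∀ u → P u
combine-ind {n} {k} P P-combine u =
  subst P (combine-remQuot {n} k u) (P-combine (proj₁ (Fin.remQuot {n} k u)) (proj₂ (Fin.remQuot {n} k u)))

pick : ∀ {n} → Fin n → Fin 2 → Fin (n ℕ.+ n)
pick {n} i zero       = i ↑ˡ n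
pick {n} i (suc zero) = n ↑ʳ i

interleave : ∀ n → Permutation (n ℕ.* 2) (n ℕ.+ n)
interleave n = Perm.permutation (uncurry pick ∘ Fin.remQuot {n} 2) unpick pick-unpick unpick-pick
  where
    unpick : Fin (n ℕ.+ n) → Fin (n ℕ.* 2)
    unpick p = [ (λ i → Fin.combine i zero) , (λ i → Fin.combine i (suc zero)) ]′ (Fin.splitAt n p)

    pick-unpick : ∀ p → uncurry pick (Fin.remQuot {n} 2 (unpick p)) ≡ p
    pick-unpick p with Fin.splitAt n p in eq
    ... | inj₁ i = trans (cong (uncurry pick) (remQuot-combine i zero)) (splitAt⁻¹-↑ˡ eq)
    ... | inj₂ i = trans (cong (uncurry pick) (remQuot-combine i (suc zero))) (splitAt⁻¹-↑ʳ eq)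

    unpick-pick : ∀ u → unpick (uncurry pick (Fin.remQuot {n} 2 u)) ≡ u
    unpick-pick = combine-ind _ λ i b → trans (cong (unpick ∘ uncurry pick) (remQuot-combine i b)) (unpick-pick′ i b)
      where
        unpick-pick′ : ∀ i b → unpick (pick i b) ≡ Fin.combine i b
        unpick-pick′ i zero       rewrite splitAt-↑ˡ n i n = refl
        unpick-pick′ i (suc zero) rewrite splitAt-↑ʳ n n i = refl

interleave-combine : ∀ {n} (i : Fin n) b → interleave n ⟨$⟩ʳ Fin.combine i b ≡ pick i b
interleave-combine {n} i b = cong (uncurry (pick {n})) (remQuot-combine {n} {2} i b)

insertAt-cong : ∀ {a n} {A : Set a} {xs ys : Vector A n} i v → xs ≗ ys → insertAt xs i v ≗ insertAt ys i v
insertAt-cong {xs = xs} {ys} i v xs≗ys = punchIn-ind i (λ r → insertAt xs i v r ≡ insertAt ys i v r)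
  (trans (insertAt-lookup xs i v) (sym (insertAt-lookup ys i v)))
  (λ k → trans (insertAt-punchIn xs i v k) (trans (xs≗ys k) (sym (insertAt-punchIn ys i v k))))

updateAt-invariant⇒constant : ∀ {a b} {A : Set a} {B : Set b} n (z : A) (F : Vector A n → B) →
                              (∀ {x y} → x ≗ y → F x ≡ F y) → (∀ x l → F x ≡ F (updateAt x l (const z))) →
                              ∀ x → F x ≡ F (const z)
updateAt-invariant⇒constant zero    z F resp invariant x = resp λ ()
updateAt-invariant⇒constant (suc n) z F resp invariant x = begin
  F x                            ≡⟨ invariant x zero ⟩
  F (updateAt x zero (const z))  ≡⟨ resp (λ { zero → refl ; (suc j) → refl }) ⟩
  F (z ∷ tail x)                 ≡⟨ updateAt-invariant⇒constant n z (F ∘ (z ∷_)) resp′ invariant′ (tail x) ⟩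
  F (z ∷ const z)                ≡⟨ resp (λ { zero → refl ; (suc j) → refl }) ⟩
  F (const z)                    ∎
  where
    open ≡-Reasoning
    resp′ : ∀ {x y} → x ≗ y → F (z ∷ x) ≡ F (z ∷ y)
    resp′ x≗y = resp λ { zero → refl ; (suc j) → x≗y j }

    invariant′ : ∀ x l → F (z ∷ x) ≡ F (z ∷ updateAt x l (const z))
    invariant′ x l = trans (invariant (z ∷ x) (suc l)) (resp λ { zero → refl ; (suc j) → refl })

module Determinant {c} {A : Set c} {plus times : Op₂ A} {negate : Op₁ A} {0ᴬ 1ᴬ : A}
  (isCommutativeRing : IsCommutativeRing _≡_ plus times negate 0ᴬ 1ᴬ) where

  private
    variable
      m n : ℕ

  commutativeRing : CommutativeRing c c
  commutativeRing = record { isCommutativeRing = isCommutativeRing }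

  open CommutativeRing commutativeRing public
    using ( _+_; _*_; -_; 0#; 1#; +-commutativeMonoid; semiring; commutativeSemiring
          ; +-assoc; +-identityˡ; +-identityʳ; -‿inverseʳ; *-assoc; *-comm; *-identityˡ; *-identityʳ
          ; zeroˡ; zeroʳ; distribˡ; distribʳ )
  open import Algebra.Properties.Ring (CommutativeRing.ring commutativeRing) public
    using (+-inverseʳ-unique; -‿involutive; -0#≈0#; -‿distribˡ-*; -1*x≈-x)
  open import Algebra.Properties.CommutativeSemiring.Exp commutativeSemiring public
    using (_^_; ^-distrib-*; ^-homo-*)
  open import Algebra.Properties.CommutativeMonoid.Sum +-commutativeMonoid public
    using (sum; sum-syntax; ∑-distrib-+; ∑-comm; ∑-permute; sum-cong-≗; sum-replicate-zero)
  open import Algebra.Properties.Semiring.Sum semiring public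
    using (*-distribˡ-sum; *-distribʳ-sum)
  open import Algebra.Solver.Ring.NaturalCoefficients.Default commutativeSemiring
    using (solve; _:+_; _:*_; _:=_; con)

  sum-zero : {f : Vector A n} → (∀ i → f i ≡ 0#) → sum f ≡ 0#
  sum-zero {n} f≗0 = trans (sum-cong-≗ f≗0) (sum-replicate-zero n)

  sum-linear : ∀ a b (f g : Vector A n) → ∑[ j < n ] (a * f j + b * g j) ≡ a * sum f + b * sum g
  sum-linear a b f g =
    trans (∑-distrib-+ (λ j → a * f j) (λ j → b * g j))
          (cong₂ _+_ (sym (*-distribˡ-sum a f)) (sym (*-distribˡ-sum b g)))

  sum-↑ : ∀ m (f : Vector A (m ℕ.+ n)) → sum f ≡ ∑[ i < m ] f (i ↑ˡ n) + ∑[ j < n ] f (m ↑ʳ j)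
  sum-↑ zero    f = sym (+-identityˡ _)
  sum-↑ (suc m) f = trans (cong (f zero +_) (sum-↑ m (f ∘ suc))) (sym (+-assoc _ _ _))

  sum-combine : ∀ m k (f : Vector A (m ℕ.* k)) → sum f ≡ ∑[ i < m ] ∑[ b < k ] f (Fin.combine i b)
  sum-combine zero    k f = refl
  sum-combine (suc m) k f =
    trans (sum-↑ k f) (cong (∑[ b < k ] f (b ↑ˡ m ℕ.* k) +_) (sum-combine m k λ u → f (k ↑ʳ u)))

  sum-adjacent : ∀ (k : Fin n) (t : Vector A (suc n)) → (∀ j → j ≢ inject₁ k → j ≢ suc k → t j ≡ 0#) →
                 sum t ≡ t (inject₁ k) + t (suc k)
  sum-adjacent {suc n} zero    t t≗0 =
    trans (sym (+-assoc (t zero) (t (suc zero)) _))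
          (trans (cong (t zero + t (suc zero) +_) (sum-zero λ j → t≗0 (suc (suc j)) (λ ()) (λ ())))
                 (+-identityʳ _))
  sum-adjacent {suc n} (suc k) t t≗0 =
    trans (cong₂ _+_ (t≗0 zero (λ ()) (λ ()))
                     (sum-adjacent k (t ∘ suc) λ j j≢k j≢sk → t≗0 (suc j) (j≢k ∘ suc-injective) (j≢sk ∘ suc-injective)))
          (+-identityˡ _)

  δ : Fin n → Fin n → A
  δ zero    zero    = 1#
  δ zero    (suc j) = 0#
  δ (suc i) zero    = 0#
  δ (suc i) (suc j) = δ i j

  δ-refl : (i : Fin n) → δ i i ≡ 1#
  δ-refl zero    = refl
  δ-refl (suc i) = δ-refl i

  δ-≢ : {i j : Fin n} → i ≢ j → δ i j ≡ 0#
  δ-≢ {i = zero}  {zero}  i≢j = ⊥-elim (i≢j refl)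
  δ-≢ {i = zero}  {suc j} _   = refl
  δ-≢ {i = suc i} {zero}  _   = refl
  δ-≢ {i = suc i} {suc j} i≢j = δ-≢ (i≢j ∘ cong suc)

  δ-sym : (i j : Fin n) → δ i j ≡ δ j i
  δ-sym zero    zero    = refl
  δ-sym zero    (suc j) = refl
  δ-sym (suc i) zero    = refl
  δ-sym (suc i) (suc j) = δ-sym i j

  δ-injective : {π : Fin m → Fin n} → (∀ {i j} → π i ≡ π j → i ≡ j) → ∀ i j → δ (π i) (π j) ≡ δ i j
  δ-injective {π = π} π-injective i j with i ≟ j
  ... | yes refl = trans (δ-refl (π i)) (sym (δ-refl i))
  ... | no i≢j   = trans (δ-≢ (i≢j ∘ π-injective)) (sym (δ-≢ i≢j))

  sum-δ : (i : Fin n) (f : Vector A n) → ∑[ j < n ] (δ i j * f j) ≡ f i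
  sum-δ zero    f = trans (cong₂ _+_ (*-identityˡ (f zero)) (sum-zero λ j → zeroˡ (f (suc j))))
                          (+-identityʳ (f zero))
  sum-δ (suc i) f = trans (cong₂ _+_ (zeroˡ (f zero)) (sum-δ i (f ∘ suc))) (+-identityˡ (f (suc i)))

  sum-δʳ : (i : Fin n) (f : Vector A n) → ∑[ j < n ] (f j * δ j i) ≡ f i
  sum-δʳ i f = trans (sum-cong-≗ λ j → trans (*-comm (f j) (δ j i)) (cong (_* f j) (δ-sym j i)))
                     (sum-δ i f)

  Matrix : ℕ → Set c
  Matrix m = Fin m → Fin m → A

  infix 4 _≐_
  _≐_ : Matrix m → Matrix m → Set c
  M ≐ N = ∀ i j → M i j ≡ N i j

  1ᴹ : Matrix m
  1ᴹ = δ

  _ᵀ : Matrix m → Matrix m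
  (M ᵀ) i j = M j i

  infixl 7 _*ᴹ_ _*ᵥ_
  _*ᴹ_ : Matrix m → Matrix m → Matrix m
  (M *ᴹ N) i j = ∑[ k < _ ] (M i k * N k j)

  _*ᵥ_ : Matrix m → Vector A m → Vector A m
  (M *ᵥ x) i = ∑[ k < _ ] (M i k * x k)

  *ᴹ-1ᴹ : ∀ (M : Matrix m) → M *ᴹ 1ᴹ ≐ M
  *ᴹ-1ᴹ M i j = sum-δʳ j (M i)

  column : Matrix m → Fin m → Vector A m
  column M l i = M i l

  infixl 6 _[_]≔_
  _[_]≔_ : Matrix m → Fin m → Vector A m → Matrix m
  (M [ l ]≔ w) i = updateAt (M i) l (const (w i))

  []≔-updates : ∀ (M : Matrix m) l w i → (M [ l ]≔ w) i l ≡ w i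
  []≔-updates M l w i = updateAt-updates l (M i)

  []≔-minimal : ∀ (M : Matrix m) {k l} w i → k ≢ l → (M [ l ]≔ w) i k ≡ M i k
  []≔-minimal M {k} {l} w i k≢l = updateAt-minimal k l (M i) k≢l

  []≔-self : ∀ (M : Matrix m) l → M [ l ]≔ column M l ≐ M
  []≔-self M l i j with j ≟ l
  ... | yes refl = []≔-updates M l (column M l) i
  ... | no j≢l   = []≔-minimal M (column M l) i j≢l

  []≔²-first : ∀ (M : Matrix m) {k l} x y i → k ≢ l → (M [ k ]≔ x [ l ]≔ y) i k ≡ x i
  []≔²-first M {k} x y i k≢l = trans ([]≔-minimal (M [ k ]≔ x) y i k≢l) ([]≔-updates M k x i)

  []≔²-other : ∀ (M : Matrix m) {j k l} x y i → j ≢ k → j ≢ l → (M [ k ]≔ x [ l ]≔ y) i j ≡ M i j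
  []≔²-other M {k = k} x y i j≢k j≢l = trans ([]≔-minimal (M [ k ]≔ x) y i j≢l) ([]≔-minimal M x i j≢k)

  ≐-from-columns : ∀ {M N : Matrix m} k l → (∀ i → M i k ≡ N i k) → (∀ i → M i l ≡ N i l) →
                   (∀ j → j ≢ k → j ≢ l → ∀ i → M i j ≡ N i j) → M ≐ N
  ≐-from-columns k l eqₖ eqₗ eqₒ i j with j ≟ k | j ≟ l
  ... | yes refl | _        = eqₖ i
  ... | no _     | yes refl = eqₗ i
  ... | no j≢k   | no j≢l   = eqₒ j j≢k j≢l i

  *ᴹ-[]≔ : ∀ (M N : Matrix m) l w → M *ᴹ (N [ l ]≔ w) ≐ (M *ᴹ N) [ l ]≔ (M *ᵥ w)
  *ᴹ-[]≔ M N l w i j with j ≟ l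
  ... | yes refl = trans (sum-cong-≗ λ k → cong (M i k *_) ([]≔-updates N j w k))
                         (sym ([]≔-updates (M *ᴹ N) j (M *ᵥ w) i))
  ... | no j≢l   = trans (sum-cong-≗ λ k → cong (M i k *_) ([]≔-minimal N w k j≢l))
                         (sym ([]≔-minimal (M *ᴹ N) (M *ᵥ w) i j≢l))

  EqualColumns : Matrix m → Fin m → Fin m → Set c
  EqualColumns M k l = ∀ i → M i k ≡ M i l

  swapColumns : Fin m → Fin m → Matrix m → Matrix m
  swapColumns k l M = M [ k ]≔ column M l [ l ]≔ column M k

  -- Alternating multilinear functions of the columns

  record IsMultilinear (f : Matrix m → A) : Set c where
    field
      resp-≐ : ∀ {M N} → M ≐ N → f M ≡ f N
      linear : ∀ M l a b {u v w : Vector A m} → (∀ i → w i ≡ a * u i + b * v i) →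
               f (M [ l ]≔ w) ≡ a * f (M [ l ]≔ u) + b * f (M [ l ]≔ v)

    additive : ∀ M l {u v w : Vector A m} → (∀ i → w i ≡ u i + v i) →
               f (M [ l ]≔ w) ≡ f (M [ l ]≔ u) + f (M [ l ]≔ v)
    additive M l {u} {v} w≗ =
      trans (linear M l 1# 1# λ i → trans (w≗ i) (sym (cong₂ _+_ (*-identityˡ (u i)) (*-identityˡ (v i)))))
            (cong₂ _+_ (*-identityˡ _) (*-identityˡ _))

    homogeneous : ∀ M l a {u w : Vector A m} → (∀ i → w i ≡ a * u i) → f (M [ l ]≔ w) ≡ a * f (M [ l ]≔ u)
    homogeneous M l a {u} w≗ =
      trans (linear M l a 0# {u} λ i → trans (w≗ i) (sym (trans (cong (a * u i +_) (zeroˡ (u i))) (+-identityʳ _))))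
            (trans (cong (a * f (M [ l ]≔ u) +_) (zeroˡ _)) (+-identityʳ _))

  IsAlternating : (Matrix m → A) → Set c
  IsAlternating f = ∀ M {k l} → k ≢ l → EqualColumns M k l → f M ≡ 0#

  swapColumns-antisymmetric : ∀ {f : Matrix m → A} → IsMultilinear f → ∀ {k l} → k ≢ l →
                              (∀ M → EqualColumns M k l → f M ≡ 0#) → ∀ M → f (swapColumns k l M) ≡ - f M
  swapColumns-antisymmetric {m} {f} multilinear {k} {l} k≢l vanish M =
    +-inverseʳ-unique (f M) (f (F v u)) (begin
      f M + f (F v u)                                    ≡⟨ cong₂ _+_ (trans (+-identityˡ (f (F u v))) (resp-≐ F-u-v))
                                                                      (+-identityʳ (f (F v u))) ⟨
      (0# + f (F u v)) + (f (F v u) + 0#)                ≡⟨ cong₂ (λ x y → (x + f (F u v)) + (f (F v u) + y)) (F-diag u) (F-diag v) ⟨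
      (f (F u u) + f (F u v)) + (f (F v u) + f (F v v))  ≡⟨ cong₂ _+_ (additive (M [ k ]≔ u) l λ _ → refl)
                                                                      (additive (M [ k ]≔ v) l λ _ → refl) ⟨
      f (F u s) + f (F v s)                              ≡⟨ cong₂ _+_ (resp-≐ (F≐G u s)) (resp-≐ (F≐G v s)) ⟩
      f (G u s) + f (G v s)                              ≡⟨ additive (M [ l ]≔ s) k (λ _ → refl) ⟨
      f (G s s)                                          ≡⟨ resp-≐ (F≐G s s) ⟨
      f (F s s)                                          ≡⟨ F-diag s ⟩
      0#                                                 ∎)
    where
      open IsMultilinear multilinear
      open ≡-Reasoning
      u v s : Vector A m
      u = column M k
      v = column M l
      s i = u i + v i

      F G : Vector A m → Vector A m → Matrix m
      F x y = M [ k ]≔ x [ l ]≔ y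
      G x y = M [ l ]≔ y [ k ]≔ x

      F≐G : ∀ x y → F x y ≐ G x y
      F≐G x y = ≐-from-columns k l
        (λ i → trans ([]≔²-first M x y i k≢l) (sym ([]≔-updates (M [ l ]≔ y) k x i)))
        (λ i → trans ([]≔-updates (M [ k ]≔ x) l y i) (sym ([]≔²-first M y x i (k≢l ∘ sym))))
        (λ j j≢k j≢l i → trans ([]≔²-other M x y i j≢k j≢l) (sym ([]≔²-other M y x i j≢l j≢k)))

      F-diag : ∀ x → f (F x x) ≡ 0#
      F-diag x = vanish (F x x) λ i → trans ([]≔²-first M x x i k≢l) (sym ([]≔-updates (M [ k ]≔ x) l x i))

      F-u-v : F u v ≐ M
      F-u-v = ≐-from-columns k l (λ i → []≔²-first M u v i k≢l) (λ i → []≔-updates (M [ k ]≔ u) l v i)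
                                 (λ j j≢k j≢l i → []≔²-other M u v i j≢k j≢l)

  record IsAlternatingMultilinear (f : Matrix m → A) : Set c where
    field
      isMultilinear : IsMultilinear f
      alternating   : IsAlternating f

    open IsMultilinear isMultilinear public

    linear-sum : ∀ M l {w : Vector A m} (a : Vector A n) (vs : Fin n → Vector A m) →
                 (∀ i → w i ≡ ∑[ t < n ] (a t * vs t i)) → f (M [ l ]≔ w) ≡ ∑[ t < n ] (a t * f (M [ l ]≔ vs t))
    linear-sum {zero}  M l {w} a vs w≗ =
      trans (homogeneous M l 0# {w} λ i → trans (w≗ i) (sym (zeroˡ (w i)))) (zeroˡ _)
    linear-sum {suc n} M l {w} a vs w≗ = begin
      f (M [ l ]≔ w)
        ≡⟨ linear M l (a zero) 1# (λ i → trans (w≗ i) (cong (a zero * vs zero i +_) (sym (*-identityˡ _)))) ⟩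
      a zero * f (M [ l ]≔ vs zero) + 1# * f (M [ l ]≔ (λ i → (∑[ t < n ] (a (suc t) * vs (suc t) i))))
        ≡⟨ cong (a zero * f (M [ l ]≔ vs zero) +_)
                (trans (*-identityˡ _) (linear-sum M l (a ∘ suc) (vs ∘ suc) (λ _ → refl))) ⟩
      (∑[ t < suc n ] (a t * f (M [ l ]≔ vs t)))   ∎
      where open ≡-Reasoning

    column-operation : ∀ M {k l} a {w : Vector A m} → k ≢ l → (∀ i → w i ≡ M i l + a * M i k) →
                       f (M [ l ]≔ w) ≡ f M
    column-operation M {k} {l} a {w} k≢l w≗ = begin
      f (M [ l ]≔ w)
        ≡⟨ linear M l 1# a (λ i → trans (w≗ i) (cong (_+ a * M i k) (sym (*-identityˡ _)))) ⟩
      1# * f (M [ l ]≔ column M l) + a * f (M [ l ]≔ column M k)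
        ≡⟨ cong₂ (λ x y → 1# * x + a * y) (resp-≐ ([]≔-self M l))
                 (alternating (M [ l ]≔ column M k) k≢l (λ i →
                    trans ([]≔-minimal M (column M k) i k≢l) (sym ([]≔-updates M l (column M k) i)))) ⟩
      1# * f M + a * 0#
        ≡⟨ cong₂ _+_ (*-identityˡ _) (zeroʳ a) ⟩
      f M + 0#
        ≡⟨ +-identityʳ _ ⟩
      f M ∎
      where open ≡-Reasoning

    swapColumns-negates : ∀ {k l} → k ≢ l → ∀ M → f (swapColumns k l M) ≡ - f M
    swapColumns-negates k≢l = swapColumns-antisymmetric isMultilinear k≢l λ M → alternating M k≢l

  sgn : Fin m → A
  sgn zero    = 1#
  sgn (suc j) = - sgn j

  sgn-inject₁ : (k : Fin n) → sgn (inject₁ k) ≡ sgn k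
  sgn-inject₁ zero    = refl
  sgn-inject₁ (suc k) = cong -_ (sgn-inject₁ k)

  minor : Matrix (suc m) → Fin (suc m) → Matrix m
  minor M j i k = M (suc i) (punchIn j k)

  det : ∀ m → Matrix m → A
  det zero    M = 1#
  det (suc m) M = ∑[ j < suc m ] (sgn j * M zero j * det m (minor M j))

  det-cong : ∀ m {M N : Matrix m} → M ≐ N → det m M ≡ det m N
  det-cong zero    M≐N = refl
  det-cong (suc m) M≐N = sum-cong-≗ λ j →
    cong₂ (λ x y → sgn j * x * y) (M≐N zero j) (det-cong m λ i k → M≐N (suc i) (punchIn j k))

  det-row₀ : ∀ m (M : Matrix (suc m)) → (∀ k → M zero (suc k) ≡ 0#) → det (suc m) M ≡ M zero zero * det m (minor M zero)
  det-row₀ m M row₀≗0 =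
    trans (cong₂ _+_ (cong (_* det m (minor M zero)) (*-identityˡ _))
                     (sum-zero λ k → trans (cong (λ x → sgn (suc k) * x * det m (minor M (suc k))) (row₀≗0 k))
                                           (trans (cong (_* det m (minor M (suc k))) (zeroʳ _)) (zeroˡ _))))
          (+-identityʳ _)

  det-1ᴹ : ∀ m → det m 1ᴹ ≡ 1#
  det-1ᴹ zero    = refl
  det-1ᴹ (suc m) = trans (det-row₀ m 1ᴹ λ _ → refl) (trans (*-identityˡ _) (det-1ᴹ m))

  minor-[]≔-self : ∀ (M : Matrix (suc m)) l w → minor (M [ l ]≔ w) l ≐ minor M l
  minor-[]≔-self M l w i k = []≔-minimal M w (suc i) (punchInᵢ≢i l k)

  minor-[]≔ : ∀ (M : Matrix (suc m)) {j l} w (j≢l : j ≢ l) →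
              minor (M [ l ]≔ w) j ≐ minor M j [ punchOut j≢l ]≔ (w ∘ suc)
  minor-[]≔ M {j} {l} w j≢l i k with k ≟ punchOut j≢l
  ... | yes refl = trans (cong ((M [ l ]≔ w) (suc i)) (punchIn-punchOut j≢l))
                         (trans ([]≔-updates M l w (suc i))
                                (sym ([]≔-updates (minor M j) (punchOut j≢l) (w ∘ suc) i)))
  ... | no k≢l′  = trans ([]≔-minimal M w (suc i) λ eq →
                           k≢l′ (punchIn-injective j k _ (trans eq (sym (punchIn-punchOut j≢l)))))
                         (sym ([]≔-minimal (minor M j) (w ∘ suc) i k≢l′))

  det-linear : ∀ m (M : Matrix m) l a b {u v w : Vector A m} → (∀ i → w i ≡ a * u i + b * v i) →
               det m (M [ l ]≔ w) ≡ a * det m (M [ l ]≔ u) + b * det m (M [ l ]≔ v)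
  det-linear (suc m) M l a b {u} {v} {w} w≗ =
    trans (sum-cong-≗ term-linear) (sum-linear a b (term u) (term v))
    where
      term : Vector A (suc m) → Fin (suc m) → A
      term x j = sgn j * (M [ l ]≔ x) zero j * det m (minor (M [ l ]≔ x) j)

      term-self : ∀ x → term x l ≡ sgn l * x zero * det m (minor M l)
      term-self x = cong₂ (λ y d → sgn l * y * d) ([]≔-updates M l x zero)
                          (det-cong m (minor-[]≔-self M l x))

      term-other : ∀ x {j} (j≢l : j ≢ l) →
                   term x j ≡ sgn j * M zero j * det m (minor M j [ punchOut j≢l ]≔ (x ∘ suc))
      term-other x {j} j≢l = cong₂ (λ y d → sgn j * y * d) ([]≔-minimal M x zero j≢l)
                               (det-cong m (minor-[]≔ M x j≢l))

      distrib-middle : ∀ s a x b y d → s * (a * x + b * y) * d ≡ a * (s * x * d) + b * (s * y * d)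
      distrib-middle = solve 6 (λ s a x b y d →
        s :* (a :* x :+ b :* y) :* d := a :* (s :* x :* d) :+ b :* (s :* y :* d)) refl

      distrib-last : ∀ s x a d b e → s * x * (a * d + b * e) ≡ a * (s * x * d) + b * (s * x * e)
      distrib-last = solve 6 (λ s x a d b e →
        s :* x :* (a :* d :+ b :* e) := a :* (s :* x :* d) :+ b :* (s :* x :* e)) refl

      term-linear : ∀ j → term w j ≡ a * term u j + b * term v j
      term-linear j with j ≟ l
      ... | yes refl = begin
        term w j                                        ≡⟨ term-self w ⟩
        sgn j * w zero * det m (minor M j)              ≡⟨ cong (λ y → sgn j * y * _) (w≗ zero) ⟩
        sgn j * (a * u zero + b * v zero) * det m (minor M j)
                                                        ≡⟨ distrib-middle _ a _ b _ _ ⟩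
        a * (sgn j * u zero * det m (minor M j)) + b * (sgn j * v zero * det m (minor M j))
                                                        ≡⟨ cong₂ (λ x y → a * x + b * y) (term-self u) (term-self v) ⟨
        a * term u j + b * term v j                     ∎
        where open ≡-Reasoning
      ... | no j≢l = begin
        term w j                                        ≡⟨ term-other w j≢l ⟩
        sgn j * M zero j * det m (minor M j [ _ ]≔ (w ∘ suc))
                                                        ≡⟨ cong (sgn j * M zero j *_)
                                                             (det-linear m (minor M j) _ a b (w≗ ∘ suc)) ⟩
        sgn j * M zero j * (a * det m (minor M j [ _ ]≔ (u ∘ suc)) + b * det m (minor M j [ _ ]≔ (v ∘ suc)))
                                                        ≡⟨ distrib-last _ _ a _ b _ ⟩
        a * (sgn j * M zero j * det m (minor M j [ _ ]≔ (u ∘ suc)))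
          + b * (sgn j * M zero j * det m (minor M j [ _ ]≔ (v ∘ suc)))
                                                        ≡⟨ cong₂ (λ x y → a * x + b * y) (term-other u j≢l) (term-other v j≢l) ⟨
        a * term u j + b * term v j                     ∎
        where open ≡-Reasoning

  det-multilinear : ∀ m → IsMultilinear (det m)
  det-multilinear m = record { resp-≐ = det-cong m ; linear = det-linear m }

  det-adjacent-equal : ∀ m (M : Matrix (suc m)) (k : Fin m) → EqualColumns M (inject₁ k) (suc k) →
                 det (suc m) M ≡ 0#
  det-adjacent-equal (suc m) M k eq = trans (sum-adjacent k term vanish) (begin
    term (inject₁ k) + term (suc k)
      ≡⟨ cong₂ (λ s d → s * M zero (inject₁ k) * d + term (suc k)) (sgn-inject₁ k) (det-cong (suc m) minors-equal) ⟩
    sgn k * M zero (inject₁ k) * D + - sgn k * M zero (suc k) * D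
      ≡⟨ cong (λ x → sgn k * M zero (inject₁ k) * D + - sgn k * x * D) (sym (eq zero)) ⟩
    sgn k * M zero (inject₁ k) * D + - sgn k * M zero (inject₁ k) * D
      ≡⟨ cancel (sgn k) (M zero (inject₁ k)) D ⟩
    0# ∎)
    where
      open ≡-Reasoning
      term : Fin (suc (suc m)) → A
      term j = sgn j * M zero j * det (suc m) (minor M j)

      D : A
      D = det (suc m) (minor M (suc k))

      vanish : ∀ j → j ≢ inject₁ k → j ≢ suc k → term j ≡ 0#
      vanish j j≢k j≢sk with punchIn-adjacent j k j≢k j≢sk
      ... | k′ , p , q = trans (cong (sgn j * M zero j *_) (det-adjacent-equal m (minor M j) k′ λ i →
                                  trans (cong (M (suc i)) p) (trans (eq (suc i)) (cong (M (suc i)) (sym q)))))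
                               (zeroʳ _)

      minors-equal : minor M (inject₁ k) ≐ minor M (suc k)
      minors-equal i l with l ≟ k
      ... | yes refl = trans (cong (M (suc i)) (punchIn-inject₁-self l))
                             (trans (sym (eq (suc i))) (cong (M (suc i)) (sym (punchIn-suc-self l))))
      ... | no l≢k   = cong (M (suc i)) (punchIn-inject₁≡punchIn-suc k l l≢k)

      cancel : ∀ a x d → a * x * d + - a * x * d ≡ 0#
      cancel a x d = trans (cong (a * x * d +_) (trans (cong (_* d) (sym (-‿distribˡ-* a x)))
                                                        (sym (-‿distribˡ-* (a * x) d))))
                           (-‿inverseʳ (a * x * d))

  -x≡0⇒x≡0 : ∀ {x} → - x ≡ 0# → x ≡ 0#
  -x≡0⇒x≡0 {x} -x≡0 = trans (sym (-‿involutive x)) (trans (cong -_ -x≡0) -0#≈0#)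

  det-equalColumns-< : ∀ m (M : Matrix m) {k l} → k Fin.< l → EqualColumns M k l → det m M ≡ 0#
  det-equalColumns-< (suc m) M {k} {l} k<l = <-weakInduction P (λ _ _ ()) step l M k k<l
    where
      P : Fin (suc m) → Set c
      P l = ∀ M k → k Fin.< l → EqualColumns M k l → det (suc m) M ≡ 0#

      step : ∀ l → P (inject₁ l) → P (suc l)
      step l hyp M k k<sl eq with k ≟ inject₁ l
      ... | yes refl = det-adjacent-equal m M l eq
      ... | no k≢l   = -x≡0⇒x≡0 (trans (sym (swapColumns-antisymmetric (det-multilinear (suc m)) l≢sl (λ N → det-adjacent-equal m N l) M))
                                       (hyp M′ k (≤∧≢⇒< (<⇒≤pred k<sl) k≢l) eq′))
        where
          l≢sl : inject₁ l ≢ suc l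
          l≢sl = <⇒≢ (≤̄⇒inject₁< ≤-refl)

          M′ : Matrix (suc m)
          M′ = swapColumns (inject₁ l) (suc l) M

          eq′ : EqualColumns M′ k (inject₁ l)
          eq′ i = trans ([]≔²-other M (column M (suc l)) (column M (inject₁ l)) i k≢l (<⇒≢ k<sl))
                        (trans (eq i) (sym ([]≔²-first M (column M (suc l)) (column M (inject₁ l)) i l≢sl)))

  det-alternating : ∀ m → IsAlternating (det m)
  det-alternating m M {k} {l} k≢l eq with <-cmp k l
  ... | tri< k<l _ _ = det-equalColumns-< m M k<l eq
  ... | tri≈ _ k≡l _ = ⊥-elim (k≢l k≡l)
  ... | tri> _ _ l<k = det-equalColumns-< m M l<k (sym ∘ eq)

  det-alternatingMultilinear : ∀ m → IsAlternatingMultilinear (det m)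
  det-alternatingMultilinear m = record { isMultilinear = det-multilinear m ; alternating = det-alternating m }

  -- Uniqueness of alternating multilinear functions

  -- first column δ i, row i continued by c, and X in the remaining rows of the other columns
  bordered : Fin (suc m) → Vector A m → Matrix m → Matrix (suc m)
  bordered i c X r zero    = δ i r
  bordered i c X r (suc l) = insertAt (column X l) i (c l) r

  bordered-[]≔ : ∀ i c (X : Matrix m) l w → bordered i c (X [ l ]≔ w) ≐ bordered i c X [ suc l ]≔ insertAt w i (c l)
  bordered-[]≔ i c X l w r zero    = refl
  bordered-[]≔ i c X l w r (suc j) with j ≟ l
  ... | yes refl = trans (insertAt-cong i (c j) ([]≔-updates X j w) r)
                         (sym ([]≔-updates (bordered i c X) (suc j) (insertAt w i (c j)) r))
  ... | no j≢l   = trans (insertAt-cong i (c j) (λ k → []≔-minimal X w k j≢l) r)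
                         (sym ([]≔-minimal (bordered i c X) (insertAt w i (c l)) r (j≢l ∘ suc-injective)))

  bordered-1ᴹ-column : ∀ (j r : Fin (suc m)) l → bordered j (const 0#) 1ᴹ r (suc l) ≡ δ (punchIn j l) r
  bordered-1ᴹ-column j r l = punchIn-ind j (λ r → bordered j (const 0#) 1ᴹ r (suc l) ≡ δ (punchIn j l) r)
    (trans (insertAt-lookup (column 1ᴹ l) j 0#) (sym (δ-≢ (punchInᵢ≢i j l))))
    (λ k → trans (insertAt-punchIn (column 1ᴹ l) j 0# k)
                 (trans (δ-sym k l) (sym (δ-injective (punchIn-injective j _ _) l k))))
    r

  module _ {f : Matrix (suc m) → A} (f-alt : IsAlternatingMultilinear f) where
    open IsAlternatingMultilinear f-alt

    bordered-alternatingMultilinear : ∀ i → IsAlternatingMultilinear (f ∘ bordered i (const 0#))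
    bordered-alternatingMultilinear i = record
      { isMultilinear = record
        { resp-≐ = λ X≐Y → resp-≐ λ { r zero → refl ; r (suc l) → insertAt-cong i 0# (λ k → X≐Y k l) r }
        ; linear = λ X l a b {u} {v} {w} w≗ → begin
            f (bordered i (const 0#) (X [ l ]≔ w))
              ≡⟨ resp-≐ (bordered-[]≔ i (const 0#) X l w) ⟩
            f (bordered i (const 0#) X [ suc l ]≔ insertAt w i 0#)
              ≡⟨ linear (bordered i (const 0#) X) (suc l) a b (insertAt-linear a b w≗) ⟩
            a * f (bordered i (const 0#) X [ suc l ]≔ insertAt u i 0#) + b * f (bordered i (const 0#) X [ suc l ]≔ insertAt v i 0#)
              ≡⟨ cong₂ (λ x y → a * x + b * y) (resp-≐ (bordered-[]≔ i (const 0#) X l u))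
                                               (resp-≐ (bordered-[]≔ i (const 0#) X l v)) ⟨
            a * f (bordered i (const 0#) (X [ l ]≔ u)) + b * f (bordered i (const 0#) (X [ l ]≔ v)) ∎
        }
      ; alternating = λ X k≢l eq → alternating (bordered i (const 0#) X) (k≢l ∘ suc-injective) (insertAt-cong i 0# eq)
      }
      where
        open ≡-Reasoning
        insertAt-linear : ∀ a b {u v w : Vector A m} → (∀ k → w k ≡ a * u k + b * v k) →
                          ∀ r → insertAt w i 0# r ≡ a * insertAt u i 0# r + b * insertAt v i 0# r
        insertAt-linear a b {u} {v} {w} w≗ = punchIn-ind i (λ r → insertAt w i 0# r ≡ a * insertAt u i 0# r + b * insertAt v i 0# r)
          (trans (insertAt-lookup w i 0#) (sym (trans (cong₂ (λ x y → a * x + b * y) (insertAt-lookup u i 0#) (insertAt-lookup v i 0#))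
                                                      (trans (cong₂ _+_ (zeroʳ a) (zeroʳ b)) (+-identityʳ 0#)))))
          (λ k → trans (insertAt-punchIn w i 0# k) (trans (w≗ k)
                   (sym (cong₂ (λ x y → a * x + b * y) (insertAt-punchIn u i 0# k) (insertAt-punchIn v i 0# k)))))

    bordered-row-irrelevant : ∀ i c (X : Matrix m) → f (bordered i c X) ≡ f (bordered i (const 0#) X)
    bordered-row-irrelevant i c X = updateAt-invariant⇒constant m 0# (λ c → f (bordered i c X))
      (λ c≗c′ → resp-≐ λ { r zero → refl ; r (suc l) → cong (λ v → insertAt (column X l) i v r) (c≗c′ l) })
      clear-entry c
      where
        clear-entry : ∀ c l → f (bordered i c X) ≡ f (bordered i (updateAt c l (const 0#)) X)
        clear-entry c l = trans (resp-≐ as-column-operation) (column-operation B′ {zero} {suc l} (c l) (λ ()) λ _ → refl)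
          where
            B′ : Matrix (suc m)
            B′ = bordered i (updateAt c l (const 0#)) X

            w : Vector A (suc m)
            w r = B′ r (suc l) + c l * B′ r zero

            at-l : ∀ r → insertAt (column X l) i (c l) r ≡ w r
            at-l = punchIn-ind i (λ r → insertAt (column X l) i (c l) r ≡ w r)
              (trans (insertAt-lookup (column X l) i (c l)) (sym (begin
                insertAt (column X l) i (updateAt c l (const 0#) l) i + c l * δ i i
                  ≡⟨ cong₂ _+_ (trans (insertAt-lookup (column X l) i _) (updateAt-updates l c)) (cong (c l *_) (δ-refl i)) ⟩
                0# + c l * 1#
                  ≡⟨ trans (+-identityˡ _) (*-identityʳ _) ⟩
                c l ∎)))
              (λ k → trans (insertAt-punchIn (column X l) i (c l) k) (sym (begin
                insertAt (column X l) i (updateAt c l (const 0#) l) (punchIn i k) + c l * δ i (punchIn i k)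
                  ≡⟨ cong₂ _+_ (insertAt-punchIn (column X l) i _ k) (cong (c l *_) (δ-≢ (punchInᵢ≢i i k ∘ sym))) ⟩
                X k l + c l * 0#
                  ≡⟨ trans (cong (X k l +_) (zeroʳ _)) (+-identityʳ _) ⟩
                X k l ∎)))
              where open ≡-Reasoning

            as-column-operation : bordered i c X ≐ B′ [ suc l ]≔ w
            as-column-operation r zero    = sym ([]≔-minimal B′ {zero} {suc l} w r λ ())
            as-column-operation r (suc j) with j ≟ l
            ... | yes refl = trans (at-l r) (sym ([]≔-updates B′ (suc j) w r))
            ... | no j≢l   = trans (cong (λ v → insertAt (column X j) i v r) (sym (updateAt-minimal j l c j≢l)))
                                   (sym ([]≔-minimal B′ w r (j≢l ∘ suc-injective)))

    bordered-1ᴹ-sign : ∀ i → f (bordered i (const 0#) 1ᴹ) ≡ sgn i * f 1ᴹ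
    bordered-1ᴹ-sign = <-weakInduction (λ i → f (bordered i (const 0#) 1ᴹ) ≡ sgn i * f 1ᴹ)
      (trans (resp-≐ bordered-zero) (sym (*-identityˡ _))) step
      where
        bordered-zero : bordered zero (const 0#) 1ᴹ ≐ 1ᴹ
        bordered-zero zero    zero    = refl
        bordered-zero (suc r) zero    = refl
        bordered-zero zero    (suc l) = refl
        bordered-zero (suc r) (suc l) = refl

        step : ∀ i → f (bordered (inject₁ i) (const 0#) 1ᴹ) ≡ sgn (inject₁ i) * f 1ᴹ →
               f (bordered (suc i) (const 0#) 1ᴹ) ≡ sgn (suc i) * f 1ᴹ
        step i hyp = begin
          f (bordered (suc i) (const 0#) 1ᴹ)   ≡⟨ resp-≐ as-swap ⟩
          f (swapColumns zero (suc i) B)       ≡⟨ swapColumns-negates {zero} {suc i} (λ ()) B ⟩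
          - f B                                ≡⟨ cong -_ (trans hyp (cong (_* f 1ᴹ) (sgn-inject₁ i))) ⟩
          - (sgn i * f 1ᴹ)                     ≡⟨ -‿distribˡ-* (sgn i) (f 1ᴹ) ⟩
          - sgn i * f 1ᴹ                       ∎
          where
            open ≡-Reasoning
            B : Matrix (suc m)
            B = bordered (inject₁ i) (const 0#) 1ᴹ

            as-swap : bordered (suc i) (const 0#) 1ᴹ ≐ swapColumns zero (suc i) B
            as-swap = ≐-from-columns zero (suc i)
              (λ r → trans (cong (λ j → δ j r) (sym (punchIn-inject₁-self i)))
                           (trans (sym (bordered-1ᴹ-column (inject₁ i) r i))
                                  (sym ([]≔²-first B {zero} {suc i} (column B (suc i)) (column B zero) r λ ()))))
              (λ r → trans (bordered-1ᴹ-column (suc i) r i)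
                           (trans (cong (λ j → δ j r) (punchIn-suc-self i))
                                  (sym ([]≔-updates (B [ zero ]≔ column B (suc i)) (suc i) (column B zero) r))))
              λ { zero 0≢0 _ → ⊥-elim (0≢0 refl)
                ; (suc j) _ j≢i r → trans (bordered-1ᴹ-column (suc i) r j)
                    (trans (cong (λ k → δ k r) (sym (punchIn-inject₁≡punchIn-suc i j (j≢i ∘ cong suc))))
                    (trans (sym (bordered-1ᴹ-column (inject₁ i) r j))
                           (sym ([]≔²-other B {suc j} {zero} {suc i} (column B (suc i)) (column B zero) r (λ ()) j≢i))))
                }

  alternatingMultilinear-unique-ᵀ : ∀ m (f : Matrix m → A) → IsAlternatingMultilinear f → ∀ M → f M ≡ det m (M ᵀ) * f 1ᴹ
  alternatingMultilinear-unique-ᵀ zero    f f-alt M = trans (IsAlternatingMultilinear.resp-≐ f-alt λ ()) (sym (*-identityˡ _))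
  alternatingMultilinear-unique-ᵀ (suc m) f f-alt M = begin
    f M                                        ≡⟨ resp-≐ ([]≔-self M zero) ⟨
    f (M [ zero ]≔ column M zero)              ≡⟨ linear-sum M zero (column M zero) δ (λ r → sym (sum-δʳ r (column M zero))) ⟩
    (∑[ i < suc m ] (M i zero * f (M [ zero ]≔ δ i)))
                                               ≡⟨ sum-cong-≗ (λ i → trans (cong (M i zero *_) (expand i)) (regroup _ _ _ _)) ⟩
    (∑[ i < suc m ] (sgn i * M i zero * det m (minor (M ᵀ) i) * f 1ᴹ))
                                               ≡⟨ *-distribʳ-sum (f 1ᴹ) (λ i → sgn i * M i zero * det m (minor (M ᵀ) i)) ⟨
    det (suc m) (M ᵀ) * f 1ᴹ                   ∎
    where
      open ≡-Reasoning
      open IsAlternatingMultilinear f-alt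

      regroup : ∀ x d s y → x * (d * (s * y)) ≡ s * x * d * y
      regroup = solve 4 (λ x d s y → x :* (d :* (s :* y)) := s :* x :* d :* y) refl

      as-bordered : ∀ i → M [ zero ]≔ δ i ≐ bordered i (M i ∘ suc) (minor (M ᵀ) i ᵀ)
      as-bordered i r zero    = refl
      as-bordered i r (suc l) = punchIn-ind i
        (λ r → M r (suc l) ≡ insertAt (column (minor (M ᵀ) i ᵀ) l) i (M i (suc l)) r)
        (sym (insertAt-lookup _ i _)) (λ k → sym (insertAt-punchIn _ i _ k)) r

      expand : ∀ i → f (M [ zero ]≔ δ i) ≡ det m (minor (M ᵀ) i) * (sgn i * f 1ᴹ)
      expand i = begin
        f (M [ zero ]≔ δ i)                                   ≡⟨ resp-≐ (as-bordered i) ⟩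
        f (bordered i (M i ∘ suc) (minor (M ᵀ) i ᵀ))          ≡⟨ bordered-row-irrelevant f-alt i _ _ ⟩
        f (bordered i (const 0#) (minor (M ᵀ) i ᵀ))           ≡⟨ alternatingMultilinear-unique-ᵀ m _ (bordered-alternatingMultilinear f-alt i) _ ⟩
        det m (minor (M ᵀ) i) * f (bordered i (const 0#) 1ᴹ)  ≡⟨ cong (det m (minor (M ᵀ) i) *_) (bordered-1ᴹ-sign f-alt i) ⟩
        det m (minor (M ᵀ) i) * (sgn i * f 1ᴹ)                ∎

  det-ᵀ : ∀ m (M : Matrix m) → det m (M ᵀ) ≡ det m M
  det-ᵀ m M = sym (trans (alternatingMultilinear-unique-ᵀ m (det m) (det-alternatingMultilinear m) M)
                         (trans (cong (det m (M ᵀ) *_) (det-1ᴹ m)) (*-identityʳ _)))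

  alternatingMultilinear-unique : ∀ m (f : Matrix m → A) → IsAlternatingMultilinear f → ∀ M → f M ≡ det m M * f 1ᴹ
  alternatingMultilinear-unique m f f-alt M = trans (alternatingMultilinear-unique-ᵀ m f f-alt M) (cong (_* f 1ᴹ) (det-ᵀ m M))

  det-*ᴹ-alternatingMultilinear : ∀ m (M : Matrix m) → IsAlternatingMultilinear (λ N → det m (M *ᴹ N))
  det-*ᴹ-alternatingMultilinear m M = record
    { isMultilinear = record
      { resp-≐ = λ N≐N′ → det-cong m λ i j → sum-cong-≗ λ k → cong (M i k *_) (N≐N′ k j)
      ; linear = λ N l a b {u} {v} {w} w≗ →
          trans (det-cong m (*ᴹ-[]≔ M N l w))
                (trans (det-linear m (M *ᴹ N) l a b λ i →
                          trans (sum-cong-≗ λ k → trans (cong (M i k *_) (w≗ k)) (distrib-inner (M i k) a (u k) b (v k)))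
                                (sum-linear a b (λ k → M i k * u k) (λ k → M i k * v k)))
                       (sym (cong₂ (λ x y → a * x + b * y) (det-cong m (*ᴹ-[]≔ M N l u)) (det-cong m (*ᴹ-[]≔ M N l v)))))
      }
    ; alternating = λ N k≢l eq → det-alternating m (M *ᴹ N) k≢l λ i → sum-cong-≗ λ k → cong (M i k *_) (eq k)
    }
    where
      distrib-inner : ∀ x a u b v → x * (a * u + b * v) ≡ a * (x * u) + b * (x * v)
      distrib-inner = solve 5 (λ x a u b v → x :* (a :* u :+ b :* v) := a :* (x :* u) :+ b :* (x :* v)) refl

  det-*ᴹ : ∀ m (M N : Matrix m) → det m (M *ᴹ N) ≡ det m M * det m N
  det-*ᴹ m M N = trans (alternatingMultilinear-unique m (λ N → det m (M *ᴹ N)) (det-*ᴹ-alternatingMultilinear m M) N)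
                       (trans (cong (det m N *_) (det-cong m (*ᴹ-1ᴹ M))) (*-comm _ _))

  det-scale : ∀ m c (M : Matrix m) → det m (λ i j → c * M i j) ≡ c ^ m * det m M
  det-scale zero    c M = sym (*-identityˡ 1#)
  det-scale (suc m) c M =
    trans (sum-cong-≗ λ j → trans (cong (sgn j * (c * M zero j) *_) (det-scale m c (minor M j)))
                                  (regroup (sgn j) c (M zero j) (c ^ m) (det m (minor M j))))
          (sym (*-distribˡ-sum (c ^ suc m) λ j → sgn j * M zero j * det m (minor M j)))
    where
      regroup : ∀ s c x p d → s * (c * x) * (p * d) ≡ c * p * (s * x * d)
      regroup = solve 5 (λ s c x p d → s :* (c :* x) :* (p :* d) := c :* p :* (s :* x :* d)) refl

  det-permute : ∀ m (π : Permutation′ m) (M : Matrix m) → det m (λ i j → M (π ⟨$⟩ʳ i) (π ⟨$⟩ʳ j)) ≡ det m M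
  det-permute m π M = begin
    det m (λ i j → M (π ⟨$⟩ʳ i) (π ⟨$⟩ʳ j))  ≡⟨ det-cong m conjugate ⟨
    det m (P *ᴹ (M *ᴹ P ᵀ))                   ≡⟨ trans (det-*ᴹ m P (M *ᴹ P ᵀ)) (cong (det m P *_) (det-*ᴹ m M (P ᵀ))) ⟩
    det m P * (det m M * det m (P ᵀ))         ≡⟨ regroup (det m P) (det m M) (det m (P ᵀ)) ⟩
    det m M * (det m P * det m (P ᵀ))         ≡⟨ cong (det m M *_) P*Pᵀ ⟩
    det m M * 1#                              ≡⟨ *-identityʳ _ ⟩
    det m M                                   ∎
    where
      open ≡-Reasoning
      P : Matrix m
      P i j = δ (π ⟨$⟩ʳ i) j

      π-injective : ∀ {i j} → π ⟨$⟩ʳ i ≡ π ⟨$⟩ʳ j → i ≡ j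
      π-injective {i} {j} eq = trans (sym (Perm.inverseˡ π)) (trans (cong (π ⟨$⟩ˡ_) eq) (Perm.inverseˡ π))

      conjugate : P *ᴹ (M *ᴹ P ᵀ) ≐ λ i j → M (π ⟨$⟩ʳ i) (π ⟨$⟩ʳ j)
      conjugate i j = trans (sum-δ (π ⟨$⟩ʳ i) λ k → (M *ᴹ P ᵀ) k j)
                            (trans (sum-cong-≗ λ l → cong (M (π ⟨$⟩ʳ i) l *_) (δ-sym (π ⟨$⟩ʳ j) l))
                                   (sum-δʳ (π ⟨$⟩ʳ j) (M (π ⟨$⟩ʳ i))))

      P*Pᵀ : det m P * det m (P ᵀ) ≡ 1#
      P*Pᵀ = trans (sym (det-*ᴹ m P (P ᵀ)))
                   (trans (det-cong m λ i j → trans (sum-δ (π ⟨$⟩ʳ i) (P j)) (trans (δ-injective π-injective j i) (δ-sym j i)))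
                          (det-1ᴹ m))

      regroup : ∀ x y z → x * (y * z) ≡ y * (x * z)
      regroup = solve 3 (λ x y z → x :* (y :* z) := y :* (x :* z)) refl

  det-reindex : ∀ (π : Permutation m n) (M : Matrix n) → det m (λ i j → M (π ⟨$⟩ʳ i) (π ⟨$⟩ʳ j)) ≡ det n M
  det-reindex {m} π M with Perm.↔⇒≡ π
  ... | refl = det-permute m π M

  blockDiagonal : ∀ n → Matrix 2 → Matrix (n ℕ.* 2)
  blockDiagonal n B u v = δ (Fin.quotient {n} 2 u) (Fin.quotient {n} 2 v) * B (Fin.remainder {n} 2 u) (Fin.remainder {n} 2 v)

  blockDiagonal-combine : ∀ n B (i j : Fin n) b b′ →
                          blockDiagonal n B (Fin.combine i b) (Fin.combine j b′) ≡ δ i j * B b b′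
  blockDiagonal-combine n B i j b b′ =
    cong₂ (λ p q → δ (proj₁ p) (proj₁ q) * B (proj₂ p) (proj₂ q)) (remQuot-combine {n} {2} i b) (remQuot-combine {n} {2} j b′)

  blockDiagonal-*ᵥ : ∀ n B (w : Vector A (n ℕ.* 2)) i b →
                     (blockDiagonal n B *ᵥ w) (Fin.combine i b) ≡ ∑[ b′ < 2 ] (B b b′ * w (Fin.combine i b′))
  blockDiagonal-*ᵥ n B w i b = begin
    ∑[ u < n ℕ.* 2 ] (blockDiagonal n B (Fin.combine i b) u * w u)
      ≡⟨ sum-combine n 2 _ ⟩
    ∑[ j < n ] ∑[ b′ < 2 ] (blockDiagonal n B (Fin.combine i b) (Fin.combine j b′) * w (Fin.combine j b′))
      ≡⟨ sum-cong-≗ (λ j → sum-cong-≗ λ b′ → trans (cong (_* w (Fin.combine j b′)) (blockDiagonal-combine n B i j b b′))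
                                                    (*-assoc _ _ _)) ⟩
    ∑[ j < n ] ∑[ b′ < 2 ] (δ i j * (B b b′ * w (Fin.combine j b′)))
      ≡⟨ sum-cong-≗ (λ j → *-distribˡ-sum (δ i j) λ b′ → B b b′ * w (Fin.combine j b′)) ⟨
    ∑[ j < n ] (δ i j * ∑[ b′ < 2 ] (B b b′ * w (Fin.combine j b′)))
      ≡⟨ sum-δ i (λ j → ∑[ b′ < 2 ] (B b b′ * w (Fin.combine j b′))) ⟩
    ∑[ b′ < 2 ] (B b b′ * w (Fin.combine i b′)) ∎
    where open ≡-Reasoning

  det-blockDiagonal : ∀ n B → det (n ℕ.* 2) (blockDiagonal n B) ≡ det 2 B ^ n
  det-blockDiagonal zero    B = refl
  det-blockDiagonal (suc n) B = begin
    det (suc (suc (n ℕ.* 2))) M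
      ≡⟨ cong (λ r → term zero + (term (suc zero) + r)) (sum-zero rest-vanishes) ⟩
    term zero + (term (suc zero) + 0#)
      ≡⟨ cong₂ (λ d₀ d₁ → 1# * M zero zero * d₀ + (- 1# * M zero (suc zero) * d₁ + 0#))
               (det-row₀ (n ℕ.* 2) (minor M zero) (λ _ → zeroˡ _))
               (det-row₀ (n ℕ.* 2) (minor M (suc zero)) (λ _ → zeroˡ _)) ⟩
    1# * M zero zero * (M (suc zero) (suc zero) * d) + (- 1# * M zero (suc zero) * (M (suc zero) zero * d) + 0#)
      ≡⟨ expand (B zero zero) (B zero (suc zero)) (B (suc zero) zero) (B (suc zero) (suc zero)) (- 1#) d ⟩
    det 2 B * d
      ≡⟨ cong (det 2 B *_) (det-blockDiagonal n B) ⟩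
    det 2 B ^ suc n ∎
    where
      open ≡-Reasoning
      M : Matrix (suc (suc (n ℕ.* 2)))
      M = blockDiagonal (suc n) B

      term : Fin (suc (suc (n ℕ.* 2))) → A
      term j = sgn j * M zero j * det (suc (n ℕ.* 2)) (minor M j)

      d : A
      d = det (n ℕ.* 2) (blockDiagonal n B)

      rest-vanishes : ∀ k → term (suc (suc k)) ≡ 0#
      rest-vanishes k = trans (cong (λ x → sgn (suc (suc k)) * x * D) (zeroˡ _)) (trans (cong (_* D) (zeroʳ _)) (zeroˡ D))
        where D = det (suc (n ℕ.* 2)) (minor M (suc (suc k)))

      -- both sides are literal Laplace expansions, with n standing for - 1#
      expand : ∀ a b c e n p → 1# * (1# * a) * ((1# * e) * p) + (n * (1# * b) * ((1# * c) * p) + 0#)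
                               ≡ (1# * a * (1# * e * 1# + 0#) + (n * b * (1# * c * 1# + 0#) + 0#)) * p
      expand = solve 6 (λ a b c e n p →
        con 1 :* (con 1 :* a) :* ((con 1 :* e) :* p) :+ (n :* (con 1 :* b) :* ((con 1 :* c) :* p) :+ con 0)
        := (con 1 :* a :* (con 1 :* e :* con 1 :+ con 0) :+ (n :* b :* (con 1 :* c :* con 1 :+ con 0) :+ con 0)) :* p) refl

  -- Quadratic forms

  infix 7 _·_
  _·_ : Vector A m → Vector A m → A
  x · y = ∑[ i < _ ] (x i * y i)

  form : Matrix m → Vector A m → A
  form M x = x · (M *ᵥ x)

  ·-cong : ∀ {x x′ y y′ : Vector A m} → x ≗ x′ → y ≗ y′ → x · y ≡ x′ · y′
  ·-cong x≗x′ y≗y′ = sum-cong-≗ λ i → cong₂ _*_ (x≗x′ i) (y≗y′ i)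

  ·-comm : ∀ (x y : Vector A m) → x · y ≡ y · x
  ·-comm x y = sum-cong-≗ λ i → *-comm (x i) (y i)

  ·-+ˡ : ∀ (x y z : Vector A m) → (λ i → x i + y i) · z ≡ x · z + y · z
  ·-+ˡ x y z = trans (sum-cong-≗ λ i → distribʳ (z i) (x i) (y i)) (∑-distrib-+ (λ i → x i * z i) (λ i → y i * z i))

  ·-+ʳ : ∀ (x y z : Vector A m) → x · (λ i → y i + z i) ≡ x · y + x · z
  ·-+ʳ x y z = trans (sum-cong-≗ λ i → distribˡ (x i) (y i) (z i)) (∑-distrib-+ (λ i → x i * y i) (λ i → x i * z i))

  *ᵥ-cong : ∀ {M N : Matrix m} {x y} → M ≐ N → x ≗ y → M *ᵥ x ≗ N *ᵥ y
  *ᵥ-cong M≐N x≗y i = sum-cong-≗ λ j → cong₂ _*_ (M≐N i j) (x≗y j)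

  *ᵥ-+ : ∀ (M : Matrix m) x y → M *ᵥ (λ i → x i + y i) ≗ λ i → (M *ᵥ x) i + (M *ᵥ y) i
  *ᵥ-+ M x y i = trans (sum-cong-≗ λ j → distribˡ (M i j) (x j) (y j)) (∑-distrib-+ (λ j → M i j * x j) (λ j → M i j * y j))

  *ᴹ-*ᵥ : ∀ (M N : Matrix m) x → (M *ᴹ N) *ᵥ x ≗ M *ᵥ (N *ᵥ x)
  *ᴹ-*ᵥ M N x i = begin
    ∑[ j < _ ] ((∑[ k < _ ] (M i k * N k j)) * x j)     ≡⟨ sum-cong-≗ (λ j → *-distribʳ-sum (x j) λ k → M i k * N k j) ⟩
    ∑[ j < _ ] ∑[ k < _ ] (M i k * N k j * x j)         ≡⟨ ∑-comm (λ j k → M i k * N k j * x j) ⟩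
    ∑[ k < _ ] ∑[ j < _ ] (M i k * N k j * x j)         ≡⟨ sum-cong-≗ (λ k → trans (sum-cong-≗ λ j → *-assoc (M i k) (N k j) (x j))
                                                                               (sym (*-distribˡ-sum (M i k) λ j → N k j * x j))) ⟩
    ∑[ k < _ ] (M i k * (∑[ j < _ ] (N k j * x j)))     ∎
    where open ≡-Reasoning

  *ᵥ-ᵀ : ∀ (M : Matrix m) x y → (M *ᵥ x) · y ≡ x · (M ᵀ *ᵥ y)
  *ᵥ-ᵀ M x y = begin
    ∑[ i < _ ] ((∑[ j < _ ] (M i j * x j)) * y i)     ≡⟨ sum-cong-≗ (λ i → *-distribʳ-sum (y i) λ j → M i j * x j) ⟩
    ∑[ i < _ ] ∑[ j < _ ] (M i j * x j * y i)         ≡⟨ ∑-comm (λ i j → M i j * x j * y i) ⟩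
    ∑[ j < _ ] ∑[ i < _ ] (M i j * x j * y i)         ≡⟨ sum-cong-≗ (λ j → trans (sum-cong-≗ λ i → regroup (M i j) (x j) (y i))
                                                                               (sym (*-distribˡ-sum (x j) λ i → M i j * y i))) ⟩
    ∑[ j < _ ] (x j * (∑[ i < _ ] (M i j * y i)))     ∎
    where
      open ≡-Reasoning
      regroup : ∀ a b c → a * b * c ≡ b * (a * c)
      regroup = solve 3 (λ a b c → a :* b :* c := b :* (a :* c)) refl

  form-cong : ∀ {M N : Matrix m} {x y} → M ≐ N → x ≗ y → form M x ≡ form N y
  form-cong M≐N x≗y = ·-cong x≗y (*ᵥ-cong M≐N x≗y)

  form-*ᵥ : ∀ (M P : Matrix m) x → form M (P *ᵥ x) ≡ form (P ᵀ *ᴹ (M *ᴹ P)) x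
  form-*ᵥ M P x = begin
    (P *ᵥ x) · (M *ᵥ (P *ᵥ x))            ≡⟨ *ᵥ-ᵀ P x (M *ᵥ (P *ᵥ x)) ⟩
    x · (P ᵀ *ᵥ (M *ᵥ (P *ᵥ x)))          ≡⟨ ·-cong (λ _ → refl) (λ i → trans (*ᴹ-*ᵥ (P ᵀ) (M *ᴹ P) x i)
                                                                          (*ᵥ-cong {M = P ᵀ} (λ _ _ → refl) (*ᴹ-*ᵥ M P x) i)) ⟨
    x · ((P ᵀ *ᴹ (M *ᴹ P)) *ᵥ x)          ∎
    where open ≡-Reasoning

  form-reindex : ∀ (π : Permutation m n) (M : Matrix n) x →
                 form M x ≡ form (λ i j → M (π ⟨$⟩ʳ i) (π ⟨$⟩ʳ j)) (λ i → x (π ⟨$⟩ʳ i))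
  form-reindex π M x =
    trans (∑-permute (λ i → x i * (M *ᵥ x) i) π)
          (sum-cong-≗ λ i → cong (x (π ⟨$⟩ʳ i) *_) (∑-permute (λ j → M (π ⟨$⟩ʳ i) j * x j) π))

  form-++ : ∀ (M : Matrix (n ℕ.+ n)) (x y : Vector A n) →
            form M (x ++ y) ≡ form (λ i j → M (i ↑ˡ n) (j ↑ˡ n)) x
                              + (x · ((λ i j → M (i ↑ˡ n) (n ↑ʳ j)) *ᵥ y) + y · ((λ i j → M (n ↑ʳ i) (j ↑ˡ n)) *ᵥ x))
                              + form (λ i j → M (n ↑ʳ i) (n ↑ʳ j)) y
  form-++ {n} M x y = begin
    form M (x ++ y)
      ≡⟨ sum-↑ n _ ⟩
    ∑[ i < n ] ((x ++ y) (i ↑ˡ n) * (M *ᵥ (x ++ y)) (i ↑ˡ n)) + ∑[ i < n ] ((x ++ y) (n ↑ʳ i) * (M *ᵥ (x ++ y)) (n ↑ʳ i))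
      ≡⟨ cong₂ _+_ (sum-cong-≗ λ i → cong₂ _*_ (lookup-++ˡ x y i) (*ᵥ-++ (i ↑ˡ n)))
                   (sum-cong-≗ λ i → cong₂ _*_ (lookup-++ʳ x y i) (*ᵥ-++ (n ↑ʳ i))) ⟩
    x · (λ i → (A′ *ᵥ x) i + (P *ᵥ y) i) + y · (λ i → (Q *ᵥ x) i + (C *ᵥ y) i)
      ≡⟨ cong₂ _+_ (·-+ʳ x (A′ *ᵥ x) (P *ᵥ y)) (·-+ʳ y (Q *ᵥ x) (C *ᵥ y)) ⟩
    (form A′ x + x · (P *ᵥ y)) + (y · (Q *ᵥ x) + form C y)
      ≡⟨ regroup (form A′ x) _ _ (form C y) ⟩
    form A′ x + (x · (P *ᵥ y) + y · (Q *ᵥ x)) + form C y ∎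
    where
      open ≡-Reasoning
      A′ P Q C : Matrix n
      A′ i j = M (i ↑ˡ n) (j ↑ˡ n)
      P  i j = M (i ↑ˡ n) (n ↑ʳ j)
      Q  i j = M (n ↑ʳ i) (j ↑ˡ n)
      C  i j = M (n ↑ʳ i) (n ↑ʳ j)

      *ᵥ-++ : ∀ p → (M *ᵥ (x ++ y)) p ≡ ∑[ j < n ] (M p (j ↑ˡ n) * x j) + ∑[ j < n ] (M p (n ↑ʳ j) * y j)
      *ᵥ-++ p = trans (sum-↑ n _) (cong₂ _+_ (sum-cong-≗ λ j → cong (M p (j ↑ˡ n) *_) (lookup-++ˡ x y j))
                                              (sum-cong-≗ λ j → cong (M p (n ↑ʳ j) *_) (lookup-++ʳ x y j)))

      regroup : ∀ a b c d → (a + b) + (c + d) ≡ a + (b + c) + d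
      regroup = solve 4 (λ a b c d → (a :+ b) :+ (c :+ d) := a :+ (b :+ c) :+ d) refl

  δ·*ᵥδ : ∀ (M : Matrix m) u v → δ u · (M *ᵥ δ v) ≡ M u v
  δ·*ᵥδ M u v = trans (sum-δ u (M *ᵥ δ v)) (trans (sum-cong-≗ λ j → cong (M u j *_) (δ-sym v j)) (sum-δʳ v (M u)))

  form-δ : ∀ (M : Matrix m) u → form M (δ u) ≡ M u u
  form-δ M u = δ·*ᵥδ M u u

  form-δ+δ : ∀ (M : Matrix m) u v → form M (λ i → δ u i + δ v i) ≡ (M u u + M u v) + (M v u + M v v)
  form-δ+δ M u v = begin
    (λ i → δ u i + δ v i) · (M *ᵥ (λ i → δ u i + δ v i))
      ≡⟨ ·-cong (λ _ → refl) (*ᵥ-+ M (δ u) (δ v)) ⟩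
    (λ i → δ u i + δ v i) · (λ i → (M *ᵥ δ u) i + (M *ᵥ δ v) i)
      ≡⟨ ·-+ˡ (δ u) (δ v) _ ⟩
    δ u · (λ i → (M *ᵥ δ u) i + (M *ᵥ δ v) i) + δ v · (λ i → (M *ᵥ δ u) i + (M *ᵥ δ v) i)
      ≡⟨ cong₂ _+_ (·-+ʳ (δ u) (M *ᵥ δ u) (M *ᵥ δ v)) (·-+ʳ (δ v) (M *ᵥ δ u) (M *ᵥ δ v)) ⟩
    (δ u · (M *ᵥ δ u) + δ u · (M *ᵥ δ v)) + (δ v · (M *ᵥ δ u) + δ v · (M *ᵥ δ v))
      ≡⟨ cong₂ _+_ (cong₂ _+_ (δ·*ᵥδ M u u) (δ·*ᵥδ M u v)) (cong₂ _+_ (δ·*ᵥδ M v u) (δ·*ᵥδ M v v)) ⟩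
    (M u u + M u v) + (M v u + M v v) ∎
    where open ≡-Reasoning

  Symmetric : Matrix m → Set c
  Symmetric M = ∀ i j → M i j ≡ M j i

  congruence-symmetric : ∀ (S P : Matrix m) → Symmetric S → Symmetric (P ᵀ *ᴹ (S *ᴹ P))
  congruence-symmetric S P S-sym i j = begin
    ∑[ k < _ ] (P k i * ∑[ l < _ ] (S k l * P l j))      ≡⟨ sum-cong-≗ (λ k → *-distribˡ-sum (P k i) λ l → S k l * P l j) ⟩
    ∑[ k < _ ] ∑[ l < _ ] (P k i * (S k l * P l j))      ≡⟨ ∑-comm (λ k l → P k i * (S k l * P l j)) ⟩
    ∑[ l < _ ] ∑[ k < _ ] (P k i * (S k l * P l j))      ≡⟨ sum-cong-≗ (λ l → sum-cong-≗ λ k → trans (cong (λ s → P k i * (s * P l j)) (S-sym k l))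
                                                              (regroup (P k i) (S l k) (P l j))) ⟩
    ∑[ l < _ ] ∑[ k < _ ] (P l j * (S l k * P k i))      ≡⟨ sum-cong-≗ (λ l → *-distribˡ-sum (P l j) λ k → S l k * P k i) ⟨
    ∑[ l < _ ] (P l j * ∑[ k < _ ] (S l k * P k i))      ∎
    where
      open ≡-Reasoning
      regroup : ∀ a s b → a * (s * b) ≡ b * (s * a)
      regroup = solve 3 (λ a s b → a :* (s :* b) := b :* (s :* a)) refl

module QuadraticField (D : ℤ) where
  open Field D using (_+K_; _*K_; -K_; _-K_; 0K; 1K; 2K; DK; τ; halfK; Dℚ; ω; e)
  open +-*-Solver using (Polynomial; solve; _:+_; _:*_; :-_; _:=_; con)

  private
    pair : ∀ {a b c d : ℚ} → a ≡ c → b ≡ d → (a , b) ≡ (c , d)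
    pair = cong₂ _,_

  +K-assoc : ∀ x y z → (x +K y) +K z ≡ x +K (y +K z)
  +K-assoc (a , b) (c , d) (e , f) = pair (ℚ.+-assoc a c e) (ℚ.+-assoc b d f)

  +K-comm : ∀ x y → x +K y ≡ y +K x
  +K-comm (a , b) (c , d) = pair (ℚ.+-comm a c) (ℚ.+-comm b d)

  +K-identityˡ : ∀ x → 0K +K x ≡ x
  +K-identityˡ (a , b) = pair (ℚ.+-identityˡ a) (ℚ.+-identityˡ b)

  +K-identityʳ : ∀ x → x +K 0K ≡ x
  +K-identityʳ (a , b) = pair (ℚ.+-identityʳ a) (ℚ.+-identityʳ b)

  -K-inverseˡ : ∀ x → (-K x) +K x ≡ 0K
  -K-inverseˡ (a , b) = pair (ℚ.+-inverseˡ a) (ℚ.+-inverseˡ b)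

  -K-inverseʳ : ∀ x → x +K (-K x) ≡ 0K
  -K-inverseʳ (a , b) = pair (ℚ.+-inverseʳ a) (ℚ.+-inverseʳ b)

  *K-assoc : ∀ x y z → (x *K y) *K z ≡ x *K (y *K z)
  *K-assoc (a , b) (c , d) (e , f) = pair
    (solve 7 (λ a b c d e f D → (a :* c :+ D :* (b :* d)) :* e :+ D :* ((a :* d :+ b :* c) :* f)
                                := a :* (c :* e :+ D :* (d :* f)) :+ D :* (b :* (c :* f :+ d :* e))) refl a b c d e f Dℚ)
    (solve 7 (λ a b c d e f D → (a :* c :+ D :* (b :* d)) :* f :+ (a :* d :+ b :* c) :* e
                                := a :* (c :* f :+ d :* e) :+ b :* (c :* e :+ D :* (d :* f))) refl a b c d e f Dℚ)

  *K-comm : ∀ x y → x *K y ≡ y *K x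
  *K-comm (a , b) (c , d) = pair
    (solve 5 (λ a b c d D → a :* c :+ D :* (b :* d) := c :* a :+ D :* (d :* b)) refl a b c d Dℚ)
    (solve 4 (λ a b c d → a :* d :+ b :* c := c :* b :+ d :* a) refl a b c d)

  *K-identityˡ : ∀ x → 1K *K x ≡ x
  *K-identityˡ (a , b) = pair
    (solve 3 (λ a b D → con 1ℚ :* a :+ D :* (con 0ℚ :* b) := a) refl a b Dℚ)
    (solve 2 (λ a b → con 1ℚ :* b :+ con 0ℚ :* a := b) refl a b)

  *K-identityʳ : ∀ x → x *K 1K ≡ x
  *K-identityʳ x = trans (*K-comm x 1K) (*K-identityˡ x)

  *K-distribˡ : ∀ x y z → x *K (y +K z) ≡ (x *K y) +K (x *K z)
  *K-distribˡ (a , b) (c , d) (e , f) = pair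
    (solve 7 (λ a b c d e f D → a :* (c :+ e) :+ D :* (b :* (d :+ f))
                                := (a :* c :+ D :* (b :* d)) :+ (a :* e :+ D :* (b :* f))) refl a b c d e f Dℚ)
    (solve 6 (λ a b c d e f → a :* (d :+ f) :+ b :* (c :+ e) := (a :* d :+ b :* c) :+ (a :* f :+ b :* e)) refl a b c d e f)

  *K-distribʳ : ∀ x y z → (y +K z) *K x ≡ (y *K x) +K (z *K x)
  *K-distribʳ x y z = trans (*K-comm (y +K z) x) (trans (*K-distribˡ x y z) (cong₂ _+K_ (*K-comm x y) (*K-comm x z)))

  K-isCommutativeRing : IsCommutativeRing _≡_ _+K_ _*K_ -K_ 0K 1K
  K-isCommutativeRing = record
    { isRing = record
      { +-isAbelianGroup = record
        { isGroup = record
          { isMonoid = record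
            { isSemigroup = record
              { isMagma = record { isEquivalence = isEquivalence ; ∙-cong = cong₂ _+K_ }
              ; assoc = +K-assoc }
            ; identity = +K-identityˡ , +K-identityʳ }
          ; inverse = -K-inverseˡ , -K-inverseʳ
          ; ⁻¹-cong = cong (λ x → -K x) }
        ; comm = +K-comm }
      ; *-cong = cong₂ _*K_
      ; *-assoc = *K-assoc
      ; *-identity = *K-identityˡ , *K-identityʳ
      ; distrib = *K-distribˡ , *K-distribʳ }
    ; *-comm = *K-comm }

  τ-+ : ∀ x y → τ (x +K y) ≡ τ x +K τ y
  τ-+ (a , b) (c , d) = pair refl (solve 2 (λ b d → :- (b :+ d) := :- b :+ :- d) refl b d)

  τ-* : ∀ x y → τ (x *K y) ≡ τ x *K τ y
  τ-* (a , b) (c , d) = pair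
    (solve 5 (λ a b c d D → a :* c :+ D :* (b :* d) := a :* c :+ D :* (:- b :* :- d)) refl a b c d Dℚ)
    (solve 4 (λ a b c d → :- (a :* d :+ b :* c) := a :* :- d :+ :- b :* c) refl a b c d)

  ½K : K
  ½K = ½ , 0ℚ

  -- ½K +K ½K computes to 1K
  half-double : ∀ x → ½K *K x +K ½K *K x ≡ x
  half-double x = trans (sym (*K-distribʳ x ½K ½K)) (*K-identityˡ x)

  halfK≡½K* : ∀ x → halfK x ≡ ½K *K x
  halfK≡½K* (a , b) = pair
    (solve 3 (λ a b D → con ½ :* a := con ½ :* a :+ D :* (con 0ℚ :* b)) refl a b Dℚ)
    (solve 2 (λ a b → con ½ :* b := con ½ :* b :+ con 0ℚ :* a) refl a b)

  τ-e : ∀ {m} (u t : Fin m) → τ (e u t) ≡ e u t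
  τ-e u t with u Fin.≟ t
  ... | yes _ = refl
  ... | no _  = refl

  symmetric-entry : ∀ a b d → halfK ((a +K b) +K (b +K d) -K a -K d) ≡ b
  symmetric-entry (a₁ , a₂) (b₁ , b₂) (d₁ , d₂) = pair (entry a₁ b₁ d₁) (entry a₂ b₂ d₂)
    where
      entry : ∀ a b d → ½ ℚ.* ((a ℚ.+ b) ℚ.+ (b ℚ.+ d) ℚ.+ ℚ.- a ℚ.+ ℚ.- d) ≡ b
      entry = solve 3 (λ a b d → con ½ :* ((a :+ b) :+ (b :+ d) :+ :- a :+ :- d) := b) refl

  ω-1mod4 : Dmod4 D ≡ 1 → ω ≡ (½ , ½)
  ω-1mod4 D≡1 with Dmod4 D ℕ.≟ 1
  ... | yes _  = refl
  ... | no D≢1 = ⊥-elim (D≢1 D≡1)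

  ω-¬1mod4 : ¬ Dmod4 D ≡ 1 → ω ≡ (0ℚ , 1ℚ)
  ω-¬1mod4 D≢1 with Dmod4 D ℕ.≟ 1
  ... | yes D≡1 = ⊥-elim (D≢1 D≡1)
  ... | no _    = refl

  discriminant-1mod4 : Dmod4 D ≡ 1 → (τ ω -K ω) *K (τ ω -K ω) ≡ DK
  discriminant-1mod4 D≡1 rewrite ω-1mod4 D≡1 = pair
    (solve 1 (λ D → re :* re :+ D :* (im :* im) := D) refl Dℚ)
    (solve 0 (re :* im :+ im :* re := con 0ℚ) refl)
    where
      -- the components of τ ω -K ω
      re im : ∀ {k} → Polynomial k
      re = con ½ :+ :- con ½
      im = :- con ½ :+ :- con ½

  discriminant-¬1mod4 : ¬ Dmod4 D ≡ 1 → (τ ω -K ω) *K (τ ω -K ω) ≡ DK *K (2K *K 2K)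
  discriminant-¬1mod4 D≢1 rewrite ω-¬1mod4 D≢1 = pair
    (solve 1 (λ D → re :* re :+ D :* (im :* im) := D :* fourRe D :+ D :* (con 0ℚ :* fourIm)) refl Dℚ)
    (solve 1 (λ D → re :* im :+ im :* re := D :* fourIm :+ con 0ℚ :* fourRe D) refl Dℚ)
    where
      -- the components of τ ω -K ω and of 2K *K 2K
      re im two fourIm : ∀ {k} → Polynomial k
      re     = con 0ℚ :+ :- con 0ℚ
      im     = :- con 1ℚ :+ :- con 1ℚ
      two    = con 1ℚ :+ con 1ℚ
      fourIm = two :* con 0ℚ :+ con 0ℚ :* two

      fourRe : ∀ {k} → Polynomial k → Polynomial k
      fourRe D = two :* two :+ D :* (con 0ℚ :* con 0ℚ)

module QuadraticForms (D : ℤ) where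
  open Field D
    using ( _+K_; _*K_; -K_; _-K_; 0K; 1K; 2K; DK; _^K_; τ; ω; halfK; ΣK; ΣΣ≤; e
          ; GenQuadForm; α; β; γ; symHalf; MG; evalG; evalQ; symMatrix; MQ; scale )
    renaming (det to detK; sgn to sgnK)
  open QuadraticField D
  open Determinant K-isCommutativeRing
  open import Algebra.Solver.Ring.NaturalCoefficients.Default commutativeSemiring
    using (solve; _:+_; _:*_; _:=_; con)

  ΣK≡sum : ∀ n (f : Fin n → K) → ΣK n f ≡ sum f
  ΣK≡sum zero    f = refl
  ΣK≡sum (suc n) f = cong (f zero +K_) (ΣK≡sum n (f ∘ suc))

  sgnK≡sgn : ∀ {n} (j : Fin n) → sgnK j ≡ sgn j
  sgnK≡sgn zero    = refl
  sgnK≡sgn (suc j) = cong (λ x → -K x) (sgnK≡sgn j)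

  detK≡det : ∀ m (M : Matrix m) → detK m M ≡ det m M
  detK≡det zero    M = refl
  detK≡det (suc m) M =
    trans (ΣK≡sum (suc m) λ j → sgnK j *K M zero j *K detK m (minor M j))
          (sum-cong-≗ λ j → cong₂ (λ s d → s *K M zero j *K d) (sgnK≡sgn j) (detK≡det m (minor M j)))

  ^K≡^ : ∀ x n → x ^K n ≡ x ^ n
  ^K≡^ x zero    = refl
  ^K≡^ x (suc n) = cong (x *K_) (^K≡^ x n)

  e≡δ : ∀ {n} (u v : Fin n) → e u v ≡ δ u v
  e≡δ u v with u Fin.≟ v
  ... | yes refl = sym (δ-refl u)
  ... | no u≢v   = sym (δ-≢ u≢v)

  symHalf-diag : ∀ {n} (c : Fin n → Fin n → K) i → symHalf c i i ≡ c i i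
  symHalf-diag c i with i Fin.≟ i
  ... | yes _  = refl
  ... | no i≢i = ⊥-elim (i≢i refl)

  symHalf-< : ∀ {n} (c : Fin n → Fin n → K) {i j} → i Fin.< j → symHalf c i j ≡ ½K *K c i j
  symHalf-< c {i} {j} i<j with i Fin.≟ j
  ... | yes refl = ⊥-elim (<-irrefl refl i<j)
  ... | no _ with i Fin.<? j
  ...   | yes _   = halfK≡½K* (c i j)
  ...   | no i≮j = ⊥-elim (i≮j i<j)

  symHalf-> : ∀ {n} (c : Fin n → Fin n → K) {i j} → j Fin.< i → symHalf c i j ≡ ½K *K c j i
  symHalf-> c {i} {j} j<i with i Fin.≟ j
  ... | yes refl = ⊥-elim (<-irrefl refl j<i)
  ... | no _ with i Fin.<? j
  ...   | yes i<j = ⊥-elim (<-asym i<j j<i)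
  ...   | no _    = halfK≡½K* (c j i)

  private
    -- ΣΣ≤ filters its summands through a local helper, which only unification can name.
    upperPart : ∀ n f → Σ[ U ∈ (Fin n → Fin n → K) ] ΣΣ≤ n f ≡ ΣK n (λ i → ΣK n (U i))
    upperPart n f = _ , refl

    upperPart-≤ : ∀ n f {i j : Fin n} → i Fin.≤ j → proj₁ (upperPart n f) i j ≡ f i j
    upperPart-≤ n f {i} {j} i≤j with i Fin.≤? j
    ... | yes _  = refl
    ... | no i≰j = ⊥-elim (i≰j i≤j)

    upperPart-> : ∀ n f {i j : Fin n} → j Fin.< i → proj₁ (upperPart n f) i j ≡ 0K
    upperPart-> n f {i} {j} j<i with i Fin.≤? j
    ... | yes i≤j = ⊥-elim (<⇒≱ j<i i≤j)
    ... | no _    = refl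

  form-symHalf : ∀ n (c : Fin n → Fin n → K) p → form (symHalf c) p ≡ ΣΣ≤ n (λ i j → c i j *K p i *K p j)
  form-symHalf n c p = begin
    form (symHalf c) p
      ≡⟨ sum-cong-≗ (λ i → trans (*-distribˡ-sum (p i) (λ j → symHalf c i j *K p j)) (sum-cong-≗ (entry i))) ⟩
    ∑[ i < n ] ∑[ j < n ] (½K *K (U i j +K U j i))
      ≡⟨ sum-cong-≗ (λ i → trans (sym (*-distribˡ-sum ½K (λ j → U i j +K U j i))) (cong (½K *K_) (∑-distrib-+ (U i) (λ j → U j i)))) ⟩
    ∑[ i < n ] (½K *K (sum (U i) +K ∑[ j < n ] U j i))
      ≡⟨ sym (*-distribˡ-sum ½K (λ i → sum (U i) +K ∑[ j < n ] U j i)) ⟩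
    ½K *K (∑[ i < n ] (sum (U i) +K ∑[ j < n ] U j i))
      ≡⟨ cong (½K *K_) (trans (∑-distrib-+ (λ i → sum (U i)) (λ i → ∑[ j < n ] U j i)) (cong (T +K_) (∑-comm (λ i j → U j i)))) ⟩
    ½K *K (T +K T)
      ≡⟨ trans (*K-distribˡ ½K T T) (half-double T) ⟩
    T
      ≡⟨ trans (sum-cong-≗ λ i → sym (ΣK≡sum n (U i))) (sym (ΣK≡sum n λ i → ΣK n (U i))) ⟩
    ΣK n (λ i → ΣK n (U i))
      ≡⟨ proj₂ (upperPart n f) ⟨
    ΣΣ≤ n f ∎
    where
      open ≡-Reasoning
      f : Fin n → Fin n → K
      f i j = c i j *K p i *K p j
      U = proj₁ (upperPart n f)
      T = ∑[ i < n ] sum (U i)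

      entry : ∀ i j → p i *K (symHalf c i j *K p j) ≡ ½K *K (U i j +K U j i)
      entry i j with <-cmp i j
      ... | tri< i<j _ _ = begin
        p i *K (symHalf c i j *K p j)     ≡⟨ cong (λ s → p i *K (s *K p j)) (symHalf-< c i<j) ⟩
        p i *K (½K *K c i j *K p j)       ≡⟨ solve 4 (λ x h a y → x :* (h :* a :* y) := h :* (a :* x :* y)) refl (p i) ½K (c i j) (p j) ⟩
        ½K *K f i j                       ≡⟨ cong (½K *K_) (sym (trans (cong₂ _+K_ (upperPart-≤ n f (<⇒≤ i<j)) (upperPart-> n f i<j)) (+K-identityʳ (f i j)))) ⟩
        ½K *K (U i j +K U j i)            ∎
      ... | tri> _ _ j<i = begin
        p i *K (symHalf c i j *K p j)     ≡⟨ cong (λ s → p i *K (s *K p j)) (symHalf-> c j<i) ⟩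
        p i *K (½K *K c j i *K p j)       ≡⟨ solve 4 (λ x h a y → x :* (h :* a :* y) := h :* (a :* y :* x)) refl (p i) ½K (c j i) (p j) ⟩
        ½K *K f j i                       ≡⟨ cong (½K *K_) (sym (trans (cong₂ _+K_ (upperPart-> n f j<i) (upperPart-≤ n f (<⇒≤ j<i))) (+K-identityˡ (f j i)))) ⟩
        ½K *K (U i j +K U j i)            ∎
      ... | tri≈ _ refl _ = begin
        p i *K (symHalf c i i *K p i)     ≡⟨ cong (λ s → p i *K (s *K p i)) (symHalf-diag c i) ⟩
        p i *K (c i i *K p i)             ≡⟨ solve 3 (λ x a y → x :* (a :* y) := a :* x :* y) refl (p i) (c i i) (p i) ⟩
        f i i                             ≡⟨ half-double (f i i) ⟨
        ½K *K f i i +K ½K *K f i i        ≡⟨ *K-distribˡ ½K (f i i) (f i i) ⟨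
        ½K *K (f i i +K f i i)            ≡⟨ cong (λ u → ½K *K (u +K u)) (upperPart-≤ n f ≤-refl) ⟨
        ½K *K (U i i +K U i i)            ∎

  cross-terms : ∀ n (b : Fin n → Fin n → K) (x y : Vector K n) →
                x · ((λ i j → halfK (b i j)) *ᵥ y) +K y · ((λ i j → halfK (b j i)) *ᵥ x)
                  ≡ ΣK n (λ i → ΣK n (λ j → b i j *K x i *K y j))
  cross-terms n b x y = begin
    x · (P *ᵥ y) +K y · (P ᵀ *ᵥ x)         ≡⟨ cong (x · (P *ᵥ y) +K_) (trans (sym (*ᵥ-ᵀ P y x)) (·-comm (P *ᵥ y) x)) ⟩
    x · (P *ᵥ y) +K x · (P *ᵥ y)           ≡⟨ cong (λ s → s +K s) half-sum ⟩
    ½K *K S +K ½K *K S                     ≡⟨ half-double S ⟩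
    S                                      ≡⟨ trans (sum-cong-≗ λ i → sym (ΣK≡sum n λ j → b i j *K x i *K y j))
                                                    (sym (ΣK≡sum n λ i → ΣK n (λ j → b i j *K x i *K y j))) ⟩
    ΣK n (λ i → ΣK n (λ j → b i j *K x i *K y j)) ∎
    where
      open ≡-Reasoning
      P : Matrix n
      P i j = halfK (b i j)

      S : K
      S = ∑[ i < n ] ∑[ j < n ] (b i j *K x i *K y j)

      half-sum : x · (P *ᵥ y) ≡ ½K *K S
      half-sum = begin
        x · (P *ᵥ y)                                     ≡⟨ sum-cong-≗ (λ i → *-distribˡ-sum (x i) (λ j → P i j *K y j)) ⟩
        ∑[ i < n ] ∑[ j < n ] (x i *K (P i j *K y j))     ≡⟨ sum-cong-≗ (λ i → sum-cong-≗ λ j → term i j) ⟩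
        ∑[ i < n ] ∑[ j < n ] (½K *K (b i j *K x i *K y j))
                                                         ≡⟨ sum-cong-≗ (λ i → sym (*-distribˡ-sum ½K (λ j → b i j *K x i *K y j))) ⟩
        ∑[ i < n ] (½K *K ∑[ j < n ] (b i j *K x i *K y j))
                                                         ≡⟨ sym (*-distribˡ-sum ½K (λ i → ∑[ j < n ] (b i j *K x i *K y j))) ⟩
        ½K *K S                                          ∎
        where
          term : ∀ i j → x i *K (P i j *K y j) ≡ ½K *K (b i j *K x i *K y j)
          term i j = trans (cong (λ h → x i *K (h *K y j)) (halfK≡½K* (b i j)))
                           (solve 4 (λ u h c v → u :* (h :* c :* v) := h :* (c :* u :* v)) refl (x i) ½K (b i j) (y j))

  module _ {n} (G : GenQuadForm n) where
    MG-↑ˡ↑ˡ : ∀ i j → MG G (i ↑ˡ n) (j ↑ˡ n) ≡ symHalf (α G) i j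
    MG-↑ˡ↑ˡ i j rewrite splitAt-↑ˡ n i n | splitAt-↑ˡ n j n = refl

    MG-↑ˡ↑ʳ : ∀ i j → MG G (i ↑ˡ n) (n ↑ʳ j) ≡ halfK (β G i j)
    MG-↑ˡ↑ʳ i j rewrite splitAt-↑ˡ n i n | splitAt-↑ʳ n n j = refl

    MG-↑ʳ↑ˡ : ∀ i j → MG G (n ↑ʳ i) (j ↑ˡ n) ≡ halfK (β G j i)
    MG-↑ʳ↑ˡ i j rewrite splitAt-↑ʳ n n i | splitAt-↑ˡ n j n = refl

    MG-↑ʳ↑ʳ : ∀ i j → MG G (n ↑ʳ i) (n ↑ʳ j) ≡ symHalf (γ G) i j
    MG-↑ʳ↑ʳ i j rewrite splitAt-↑ʳ n n i | splitAt-↑ʳ n n j = refl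

    evalG≡form : ∀ z → evalG G z ≡ form (MG G) (z ++ (τ ∘ z))
    evalG≡form z = sym (begin
      form (MG G) (z ++ (τ ∘ z))
        ≡⟨ form-++ (MG G) z (τ ∘ z) ⟩
      form (λ i j → MG G (i ↑ˡ n) (j ↑ˡ n)) z
        +K (z · ((λ i j → MG G (i ↑ˡ n) (n ↑ʳ j)) *ᵥ (τ ∘ z)) +K (τ ∘ z) · ((λ i j → MG G (n ↑ʳ i) (j ↑ˡ n)) *ᵥ z))
        +K form (λ i j → MG G (n ↑ʳ i) (n ↑ʳ j)) (τ ∘ z)
        ≡⟨ cong₂ _+K_ (cong₂ _+K_ (trans (form-cong {x = z} MG-↑ˡ↑ˡ (λ _ → refl)) (form-symHalf n (α G) z))
                                  (trans (cong₂ _+K_ (·-cong {x = z} (λ _ → refl) (*ᵥ-cong {x = τ ∘ z} MG-↑ˡ↑ʳ (λ _ → refl)))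
                                                     (·-cong {x = τ ∘ z} (λ _ → refl) (*ᵥ-cong {x = z} MG-↑ʳ↑ˡ (λ _ → refl))))
                                         (cross-terms n (β G) z (τ ∘ z))))
                      (trans (form-cong {x = τ ∘ z} MG-↑ʳ↑ʳ (λ _ → refl)) (form-symHalf n (γ G) (τ ∘ z))) ⟩
      evalG G z ∎)
      where open ≡-Reasoning

  symHalf-symmetric : ∀ {n} (c : Fin n → Fin n → K) → Symmetric (symHalf c)
  symHalf-symmetric c i j with <-cmp i j
  ... | tri< i<j _ _ = trans (symHalf-< c i<j) (sym (symHalf-> c i<j))
  ... | tri≈ _ refl _ = refl
  ... | tri> _ _ j<i = trans (symHalf-> c j<i) (sym (symHalf-< c j<i))

  MG-symmetric : ∀ {n} (G : GenQuadForm n) → Symmetric (MG G)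
  MG-symmetric {n} G u v with Fin.splitAt n u | Fin.splitAt n v
  ... | inj₁ i | inj₁ j = symHalf-symmetric (α G) i j
  ... | inj₁ i | inj₂ j = refl
  ... | inj₂ i | inj₁ j = refl
  ... | inj₂ i | inj₂ j = symHalf-symmetric (γ G) i j

  Rational : ∀ {m} → Vector K m → Set
  Rational w = ∀ u → τ (w u) ≡ w u

  form-e : ∀ {m} (Y : Matrix m) u → form Y (e u) ≡ Y u u
  form-e Y u = trans (form-cong {M = Y} (λ _ _ → refl) (e≡δ u)) (form-δ Y u)

  symMatrix-form : ∀ {m} (q : Vector K m → K) (Y : Matrix m) → Symmetric Y →
                   (∀ w → Rational w → q w ≡ form Y w) → symMatrix q ≐ Y
  symMatrix-form q Y Y-sym q≡form u v with u Fin.≟ v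
  ... | yes refl = trans (q≡form (e u) (τ-e u)) (form-e Y u)
  ... | no _     = begin
    halfK (q (λ t → e u t +K e v t) -K q (e u) -K q (e v))
      ≡⟨ cong₂ (λ s t → halfK (s -K t -K q (e v))) (q≡form _ e+e-rational) (q≡form (e u) (τ-e u)) ⟩
    halfK (form Y (λ t → e u t +K e v t) -K form Y (e u) -K q (e v))
      ≡⟨ cong₃ (trans (form-cong {M = Y} (λ _ _ → refl) λ t → cong₂ _+K_ (e≡δ u t) (e≡δ v t)) (form-δ+δ Y u v))
               (form-e Y u) (trans (q≡form (e v) (τ-e v)) (form-e Y v)) ⟩
    halfK ((Y u u +K Y u v) +K (Y v u +K Y v v) -K Y u u -K Y v v)
      ≡⟨ cong (λ t → halfK ((Y u u +K Y u v) +K (t +K Y v v) -K Y u u -K Y v v)) (Y-sym v u) ⟩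
    halfK ((Y u u +K Y u v) +K (Y u v +K Y v v) -K Y u u -K Y v v)
      ≡⟨ symmetric-entry (Y u u) (Y u v) (Y v v) ⟩
    Y u v ∎
    where
      open ≡-Reasoning
      e+e-rational : Rational (λ t → e u t +K e v t)
      e+e-rational t = trans (τ-+ (e u t) (e v t)) (cong₂ _+K_ (τ-e u t) (τ-e v t))

      cong₃ : ∀ {a b c a′ b′ c′} → a ≡ a′ → b ≡ b′ → c ≡ c′ → halfK (a -K b -K c) ≡ halfK (a′ -K b′ -K c′)
      cong₃ refl refl refl = refl

  Ω : Matrix 2
  Ω zero       zero       = 1K
  Ω zero       (suc zero) = ω
  Ω (suc zero) zero       = 1K
  Ω (suc zero) (suc zero) = τ ω

  det-Ω : det 2 Ω ≡ τ ω -K ω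
  det-Ω = trans (solve 3 (λ t w n → con 1 :* con 1 :* (con 1 :* t :* con 1 :+ con 0)
                                    :+ (n :* w :* (con 1 :* con 1 :* con 1 :+ con 0) :+ con 0)
                                    := t :+ n :* w) refl (τ ω) ω (-K 1K))
                (cong (τ ω +K_) (-1*x≈-x ω))

  module _ {n} (G : GenQuadForm n) where
    MG′ T : Matrix (n ℕ.* 2)
    MG′ u v = MG G (interleave n ⟨$⟩ʳ u) (interleave n ⟨$⟩ʳ v)
    T = blockDiagonal n Ω

    evalQ≡form : ∀ w → Rational w → evalQ G w ≡ form (T ᵀ *ᴹ (MG′ *ᴹ T)) w
    evalQ≡form w w-rational = begin
      evalG G z                                               ≡⟨ evalG≡form G z ⟩
      form (MG G) (z ++ (τ ∘ z))                              ≡⟨ form-reindex (interleave n) (MG G) (z ++ (τ ∘ z)) ⟩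
      form MG′ (λ u → (z ++ (τ ∘ z)) (interleave n ⟨$⟩ʳ u))   ≡⟨ form-cong {M = MG′} (λ _ _ → refl) coordinates ⟩
      form MG′ (T *ᵥ w)                                       ≡⟨ form-*ᵥ MG′ T w ⟩
      form (T ᵀ *ᴹ (MG′ *ᴹ T)) w                              ∎
      where
        open ≡-Reasoning
        x y z : Fin n → K
        x i = w (Fin.combine i zero)
        y i = w (Fin.combine i (suc zero))
        z i = x i +K y i *K ω

        as-row : ∀ i t → x i +K y i *K t ≡ 1K *K x i +K (t *K y i +K 0K)
        as-row i t = solve 3 (λ x y t → x :+ y :* t := con 1 :* x :+ (t :* y :+ con 0)) refl (x i) (y i) t

        at-pick : ∀ i c → (z ++ (τ ∘ z)) (pick i c) ≡ ∑[ c′ < 2 ] (Ω c c′ *K w (Fin.combine i c′))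
        at-pick i zero       = trans (lookup-++ˡ z (τ ∘ z) i) (as-row i ω)
        at-pick i (suc zero) = begin
          (z ++ (τ ∘ z)) (n ↑ʳ i)      ≡⟨ lookup-++ʳ z (τ ∘ z) i ⟩
          τ (x i +K y i *K ω)          ≡⟨ trans (τ-+ (x i) (y i *K ω)) (cong (τ (x i) +K_) (τ-* (y i) ω)) ⟩
          τ (x i) +K τ (y i) *K τ ω    ≡⟨ cong₂ (λ a b → a +K b *K τ ω) (w-rational _) (w-rational _) ⟩
          x i +K y i *K τ ω            ≡⟨ as-row i (τ ω) ⟩
          _                            ∎

        coordinates : ∀ u → (z ++ (τ ∘ z)) (interleave n ⟨$⟩ʳ u) ≡ (T *ᵥ w) u
        coordinates = combine-ind _ λ i c → trans (cong (z ++ (τ ∘ z)) (interleave-combine i c))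
                                                 (trans (at-pick i c) (sym (blockDiagonal-*ᵥ n Ω w i c)))

    MQ≐ : MQ G ≐ T ᵀ *ᴹ (MG′ *ᴹ T)
    MQ≐ = symMatrix-form (evalQ G) (T ᵀ *ᴹ (MG′ *ᴹ T))
                         (congruence-symmetric MG′ T λ u v → MG-symmetric G _ _) evalQ≡form

    det-MQ : detK (n ℕ.* 2) (MQ G) ≡ ((τ ω -K ω) *K (τ ω -K ω)) ^K n *K detK (n ℕ.+ n) (MG G)
    det-MQ = begin
      detK (n ℕ.* 2) (MQ G)                    ≡⟨ trans (detK≡det _ (MQ G)) (det-cong _ MQ≐) ⟩
      det _ (T ᵀ *ᴹ (MG′ *ᴹ T))                ≡⟨ trans (det-*ᴹ _ (T ᵀ) _) (cong (det _ (T ᵀ) *K_) (det-*ᴹ _ MG′ T)) ⟩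
      det _ (T ᵀ) *K (det _ MG′ *K det _ T)    ≡⟨ cong₂ (λ s t → s *K (t *K det _ T)) (det-ᵀ _ T) (det-reindex (interleave n) (MG G)) ⟩
      d *K (Δ *K d)                            ≡⟨ solve 2 (λ d Δ → d :* (Δ :* d) := d :* d :* Δ) refl d Δ ⟩
      d *K d *K Δ                              ≡⟨ cong (λ t → t *K t *K Δ) (det-blockDiagonal n Ω) ⟩
      det 2 Ω ^ n *K det 2 Ω ^ n *K Δ          ≡⟨ cong (_*K Δ) (sym (^-distrib-* (det 2 Ω) (det 2 Ω) n)) ⟩
      (det 2 Ω *K det 2 Ω) ^ n *K Δ            ≡⟨ cong (λ t → (t *K t) ^ n *K Δ) det-Ω ⟩
      ((τ ω -K ω) *K (τ ω -K ω)) ^ n *K Δ      ≡⟨ cong₂ _*K_ (sym (^K≡^ _ n)) (sym (detK≡det (n ℕ.+ n) (MG G))) ⟩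
      ((τ ω -K ω) *K (τ ω -K ω)) ^K n *K detK (n ℕ.+ n) (MG G) ∎
      where
        open ≡-Reasoning
        d Δ : K
        d = det (n ℕ.* 2) T
        Δ = det (n ℕ.+ n) (MG G)

    det-MQ-1mod4 : Dmod4 D ≡ 1 → detK (n ℕ.* 2) (MQ G) ≡ DK ^K n *K detK (n ℕ.+ n) (MG G)
    det-MQ-1mod4 D≡1 = trans det-MQ (cong (λ t → t ^K n *K detK (n ℕ.+ n) (MG G)) (discriminant-1mod4 D≡1))

    det-MQ-¬1mod4 : ¬ Dmod4 D ≡ 1 → detK (n ℕ.* 2) (MQ G) ≡ DK ^K n *K detK (n ℕ.+ n) (scale 2K (MG G))
    det-MQ-¬1mod4 D≢1 = begin
      detK (n ℕ.* 2) (MQ G)                     ≡⟨ det-MQ ⟩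
      ((τ ω -K ω) *K (τ ω -K ω)) ^K n *K detK (n ℕ.+ n) (MG G)
                                                ≡⟨ cong₂ _*K_ (trans (cong (_^K n) (discriminant-¬1mod4 D≢1)) (^K≡^ _ n))
                                                              (detK≡det (n ℕ.+ n) (MG G)) ⟩
      (DK *K (2K *K 2K)) ^ n *K Δ               ≡⟨ trans (cong (_*K Δ) (^-distrib-* DK (2K *K 2K) n)) (*-assoc (DK ^ n) _ Δ) ⟩
      DK ^ n *K ((2K *K 2K) ^ n *K Δ)           ≡⟨ cong₂ (λ t s → t *K (s *K Δ)) (sym (^K≡^ DK n))
                                                              (trans (^-distrib-* 2K 2K n) (sym (^-homo-* 2K n n))) ⟩
      DK ^K n *K (2K ^ (n ℕ.+ n) *K Δ)          ≡⟨ cong (DK ^K n *K_) (trans (sym (det-scale (n ℕ.+ n) 2K (MG G)))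
                                                                             (sym (detK≡det (n ℕ.+ n) (scale 2K (MG G))))) ⟩
      DK ^K n *K detK (n ℕ.+ n) (scale 2K (MG G)) ∎
      where
        open ≡-Reasoning
        Δ : K
        Δ = det (n ℕ.+ n) (MG G)

lemma4p2 : (D : ℤ) → ¬ (D ≡ Data.Integer.+ 0) → ¬ (D ≡ Data.Integer.+ 1) → SquareFree D →
    (n : ℕ) → (G : Field.GenQuadForm D n) →
    ((Dmod4 D ≡ 2 ⊎ Dmod4 D ≡ 3) →
      Field.det D (n Data.Nat.* 2) (Field.MQ D G)
        ≡ Field._*K_ D (Field._^K_ D (Field.DK D) n)
            (Field.det D (n Data.Nat.+ n) (Field.scale D (Field.2K D) (Field.MG D G))))
    × (Dmod4 D ≡ 1 →
      Field.det D (n Data.Nat.* 2) (Field.MQ D G)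
        ≡ Field._*K_ D (Field._^K_ D (Field.DK D) n) (Field.det D (n Data.Nat.+ n) (Field.MG D G)))
lemma4p2 D _ _ _ n G = (λ D≡2∨3 → det-MQ-¬1mod4 G (≢1 D≡2∨3)) , det-MQ-1mod4 G
  where
    open QuadraticForms D

    ≢1 : ∀ {k} → k ≡ 2 ⊎ k ≡ 3 → k ≢ 1
    ≢1 (inj₁ refl) ()
    ≢1 (inj₂ refl) ()
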